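{- Let $q$ be an odd prime power and $G=\mathrm{PSL}(2,q^2)$ acting on the projective line $\mathrm{PG}(1,q^2)$. Let $\Omega_1,\Omega_2$ be sublines of $\mathrm{PG}(1,q^2)$ lying in different $G$-orbits (no element of $G$ maps $\Omega_1$ to $\Omega_2$). Then for every $g\in G$, $|g(\Omega_1)\cap\Omega_2|\in\{0,2\}$.
   Context: A subline is the image under $\mathrm{PGL}(2,q^2)$ of $\mathrm{PG}(1,q)=\{[x,y]: x,y\in\mathbb{F}_q \text{ not both } 0\}\subseteq\mathrm{PG}(1,q^2)$; it is a set of $q+1$ points. $\mathrm{PSL}(2,q^2)$ has exactly two orbits on sublines. -}

module Defs where

open import Level using (0ℓ)
open import Data.Nat using (ℕ; zero; suc; _^_)
open import Data.Nat.Divisibility using (_∣_)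
open import Data.Nat.Primality using (Prime)
open import Data.Fin using (Fin)
open import Data.Product using (Σ; ∃; _×_; _,_)
open import Data.Sum using (_⊎_)
open import Relation.Nullary using (¬_)
open import Relation.Binary.PropositionalEquality using (_≡_)
import Relation.Binary.PropositionalEquality as Eq
open import Function.Bundles using (Bijection)
open import Algebra.Bundles using (CommutativeRing)

OddPrimePower : ℕ → Set
OddPrimePower q = (∃ λ p → ∃ λ k → Prime p × q ≡ p ^ suc k) × ¬ (2 ∣ q)

record IsField (R : CommutativeRing 0ℓ 0ℓ) : Set where
  open CommutativeRing R
  field
    nontrivial : ¬ (1# ≈ 0#)
    inverse    : ∀ x → ¬ (x ≈ 0#) → ∃ λ y → x * y ≈ 1#

HasSize : CommutativeRing 0ℓ 0ℓ → ℕ → Set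
HasSize R n = Bijection (Eq.setoid (Fin n)) (CommutativeRing.setoid R)

module PL (R : CommutativeRing 0ℓ 0ℓ) (q : ℕ) where
  open CommutativeRing R

  -- vectors of R², representing projective points when nonzero
  V2 : Set
  V2 = Carrier × Carrier

  NonZeroV : V2 → Set
  NonZeroV (x , y) = ¬ (x ≈ 0# × y ≈ 0#)

  _∼_ : V2 → V2 → Set
  (x , y) ∼ (x' , y') = x * y' ≈ y * x'

  pow : Carrier → ℕ → Carrier
  pow x zero = 1#
  pow x (suc n) = x * pow x n

  -- the subfield GF(q) of GF(q²): fixed points of the Frobenius x ↦ x^q
  InSubfield : Carrier → Set
  InSubfield x = pow x q ≈ x

  record Mat : Set where
    constructor mat
    field a b c d : Carrier

  det : Mat → Carrier
  det (mat a b c d) = a * d + - (b * c)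

  apply : Mat → V2 → V2
  apply (mat a b c d) (x , y) = (a * x + b * y , c * x + d * y)

  PointSet : Set₁
  PointSet = V2 → Set

  PG1q : PointSet
  PG1q v = ∃ λ x → ∃ λ y → InSubfield x × InSubfield y × NonZeroV (x , y) × (x , y) ∼ v

  Image : Mat → PointSet → PointSet
  Image M S v = ∃ λ w → NonZeroV w × S w × apply M w ∼ v

  IsSubline : PointSet → Set
  IsSubline Ω = ∃ λ M → ¬ (det M ≈ 0#) ×
                  (∀ v → NonZeroV v → (Ω v → Image M PG1q v) × (Image M PG1q v → Ω v))

  SameSet : PointSet → PointSet → Set
  SameSet S T = ∀ v → NonZeroV v → (S v → T v) × (T v → S v)

  -- elements of PSL(2,q²) are represented by matrices of determinant 1
  InSL : Mat → Set
  InSL g = det g ≈ 1#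

  Card0 : PointSet → Set
  Card0 S = ∀ v → NonZeroV v → ¬ S v

  Card2 : PointSet → Set
  Card2 S = ∃ λ u → ∃ λ w → NonZeroV u × NonZeroV w × S u × S w × ¬ (u ∼ w) ×
              (∀ v → NonZeroV v → S v → (v ∼ u) ⊎ (v ∼ w))

  _∩_ : PointSet → PointSet → PointSet
  (S ∩ T) v = S v × T v

module Submission where

-- Write Ωᵢ = Mᵢ(PG(1,q)) and let σ x = x ^ q, the involutive automorphism of GF(q²) with fixed
-- field GF(q); a point z lies on PG(1,q) exactly when z ∼ σ z. For g ∈ SL(2,q²) the points of
-- g Ω₁ ∩ Ω₂ correspond to the rational w with N w ∼ σ (N w), where N = adj(M₂) g M₁. Suppose w₁ is
-- one of them and w₂ is rational with Δ = det(w₁,w₂) ≠ 0. Writing Δ w = s w₁ + t w₂ with s, t in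
-- GF(q), the condition on w becomes t (s α + t β) = 0 for constants α, β with σ α = - α and
-- σ β = - β. If α ≠ 0 the solutions are t = 0 and s = - (β/α) t, i.e. exactly two points. If α = 0,
-- det N is an element of GF(q)* times a square, and then a rescaling of M₂ adj(M₁) has determinant
-- 1 and maps Ω₁ onto Ω₂, against the hypothesis. That σ is an involutive automorphism follows from
-- the binomial theorem in characteristic p and from x ^ (q * q) = x, obtained by comparing the
-- product of all field elements with the product of their multiples by x.

open import Level using (0ℓ)
open import Algebra.Bundles using (CommutativeRing; CommutativeMonoid)
open import Data.Nat as ℕ using (ℕ; zero; suc; _!; _∸_)
import Data.Nat.Properties as ℕ
open import Data.Nat.Divisibility using (_∣_; divides; ∣⇒≤)
open import Data.Nat.DivMod using (m/n*n≡m)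
open import Data.Nat.Primality using (Prime; euclidsLemma; prime⇒nonTrivial; prime⇒nonZero)
open import Data.Nat.Combinatorics using (_C_; nCk≡n!/k![n-k]!; k![n∸k]!∣n!; nCn≡1)
open import Data.Integer as ℤ using (ℤ; +_; -[1+_]; _⊖_)
import Data.Integer.Properties as ℤ
open import Data.Sign as Sign using (Sign)
open import Data.Fin as Fin using (Fin; toℕ; fromℕ; inject₁; punchIn)
import Data.Fin.Properties as Fin
open import Data.Maybe using (Maybe; just; nothing)
open import Data.Product using (∃; ∃₂; _×_; _,_; proj₁; proj₂)
open import Data.Sum using (_⊎_; inj₁; inj₂)
import Data.Sum as ⊎
open import Data.Empty using (⊥-elim)
open import Function using (_∘_)
open import Function.Bundles using (Bijection; Inverse)
open import Function.Properties.Bijection using (Bijection⇒Inverse)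
import Function.Construct.Composition as Composition
import Function.Construct.Symmetry as Symmetry
open import Relation.Binary.Bundles using (Setoid)
open import Data.Product.Relation.Binary.Pointwise.NonDependent using (×-setoid)
open import Relation.Nullary using (¬_; Dec; yes; no; contradiction)
open import Relation.Nullary.Decidable using (¬?; _×-dec_)
open import Relation.Binary.Definitions using (Decidable)
open import Relation.Binary.PropositionalEquality as ≡ using (_≡_; _≢_)
open import Defs

-- The ring solver normalises with coefficients in a ring mapping to R; ℤ does so for every R.
module IntegerCoefficients {c ℓ} (R : CommutativeRing c ℓ) where
  open CommutativeRing R
  open import Algebra.Properties.Ring ring using (-0#≈0#; -‿involutive; -‿distribˡ-*; -‿distribʳ-*)
  open import Algebra.Properties.AbelianGroup +-abelianGroup using (⁻¹-∙-comm)
  open import Algebra.Properties.CommutativeSemigroup +-commutativeSemigroup using (interchange)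
  open import Algebra.Properties.Semiring.Mult.TCOptimised semiring using (×-homo-+; ×1-homo-*; 1+×) renaming (_×_ to _·_)
  open import Algebra.Solver.Ring.AlmostCommutativeRing using (fromCommutativeRing; _-Raw-AlmostCommutative⟶_)
  open import Relation.Binary.Reasoning.Setoid setoid

  ⟦_⟧ : ℤ → Carrier
  ⟦ + n ⟧ = n · 1#
  ⟦ -[1+ n ] ⟧ = - (suc n · 1#)

  ⊖-homo : ∀ m n → ⟦ m ⊖ n ⟧ ≈ m · 1# - n · 1#
  ⊖-homo m zero = sym (trans (+-congˡ -0#≈0#) (+-identityʳ _))
  ⊖-homo zero (suc n) = sym (+-identityˡ _)
  ⊖-homo (suc m) (suc n) = begin
    ⟦ suc m ⊖ suc n ⟧                    ≡⟨ ≡.cong ⟦_⟧ (ℤ.[1+m]⊖[1+n]≡m⊖n m n) ⟩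
    ⟦ m ⊖ n ⟧                            ≈⟨ ⊖-homo m n ⟩
    m · 1# - n · 1#                      ≈⟨ +-identityˡ _ ⟨
    0# + (m · 1# - n · 1#)               ≈⟨ +-congʳ (-‿inverseʳ 1#) ⟨
    (1# - 1#) + (m · 1# - n · 1#)        ≈⟨ interchange 1# (- 1#) (m · 1#) (- (n · 1#)) ⟩
    (1# + m · 1#) + (- 1# - n · 1#)      ≈⟨ +-congˡ (⁻¹-∙-comm 1# (n · 1#)) ⟩
    (1# + m · 1#) - (1# + n · 1#)        ≈⟨ +-cong (1+× m 1#) (-‿cong (1+× n 1#)) ⟨
    suc m · 1# - suc n · 1#              ∎

  signed : Sign → Carrier → Carrier
  signed Sign.+ x = x
  signed Sign.- x = - x

  signed-cong : ∀ s {x y} → x ≈ y → signed s x ≈ signed s y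
  signed-cong Sign.+ x≈y = x≈y
  signed-cong Sign.- x≈y = -‿cong x≈y

  signed-* : ∀ s t x y → signed s x * signed t y ≈ signed (s Sign.* t) (x * y)
  signed-* Sign.+ Sign.+ x y = refl
  signed-* Sign.+ Sign.- x y = sym (-‿distribʳ-* x y)
  signed-* Sign.- Sign.+ x y = sym (-‿distribˡ-* x y)
  signed-* Sign.- Sign.- x y = begin
    - x * - y     ≈⟨ -‿distribˡ-* x (- y) ⟨
    - (x * - y)   ≈⟨ -‿cong (-‿distribʳ-* x y) ⟨
    - - (x * y)   ≈⟨ -‿involutive _ ⟩
    x * y         ∎

  ◃-homo : ∀ s n → ⟦ s ℤ.◃ n ⟧ ≈ signed s (n · 1#)
  ◃-homo Sign.+ zero = refl
  ◃-homo Sign.- zero = sym -0#≈0#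
  ◃-homo Sign.+ (suc n) = refl
  ◃-homo Sign.- (suc n) = refl

  ⟦⟧-signAbs : ∀ i → ⟦ i ⟧ ≈ signed (ℤ.sign i) (ℤ.∣ i ∣ · 1#)
  ⟦⟧-signAbs (+ n) = refl
  ⟦⟧-signAbs -[1+ n ] = refl

  +-homo : ∀ i j → ⟦ i ℤ.+ j ⟧ ≈ ⟦ i ⟧ + ⟦ j ⟧
  +-homo (+ m) (+ n) = ×-homo-+ 1# m n
  +-homo (+ m) -[1+ n ] = ⊖-homo m (suc n)
  +-homo -[1+ m ] (+ n) = trans (⊖-homo n (suc m)) (+-comm _ _)
  +-homo -[1+ m ] -[1+ n ] = begin
    - (suc (suc (m ℕ.+ n)) · 1#)   ≡⟨ ≡.cong (λ k → - (suc k · 1#)) (ℕ.+-suc m n) ⟨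
    - ((suc m ℕ.+ suc n) · 1#)     ≈⟨ -‿cong (×-homo-+ 1# (suc m) (suc n)) ⟩
    - (suc m · 1# + suc n · 1#)    ≈⟨ ⁻¹-∙-comm _ _ ⟨
    - (suc m · 1#) - suc n · 1#    ∎

  *-homo : ∀ i j → ⟦ i ℤ.* j ⟧ ≈ ⟦ i ⟧ * ⟦ j ⟧
  *-homo i j = begin
    ⟦ i ℤ.* j ⟧                                       ≈⟨ ◃-homo (s Sign.* t) (ℤ.∣ i ∣ ℕ.* ℤ.∣ j ∣) ⟩
    signed (s Sign.* t) ((ℤ.∣ i ∣ ℕ.* ℤ.∣ j ∣) · 1#)  ≈⟨ signed-cong (s Sign.* t) (×1-homo-* ℤ.∣ i ∣ ℤ.∣ j ∣) ⟩
    signed (s Sign.* t) (ℤ.∣ i ∣ · 1# * ℤ.∣ j ∣ · 1#) ≈⟨ signed-* s t _ _ ⟨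
    signed s (ℤ.∣ i ∣ · 1#) * signed t (ℤ.∣ j ∣ · 1#) ≈⟨ *-cong (⟦⟧-signAbs i) (⟦⟧-signAbs j) ⟨
    ⟦ i ⟧ * ⟦ j ⟧                                     ∎
    where s = ℤ.sign i; t = ℤ.sign j

  -‿homo : ∀ i → ⟦ ℤ.- i ⟧ ≈ - ⟦ i ⟧
  -‿homo (+ zero) = sym -0#≈0#
  -‿homo (+ suc n) = refl
  -‿homo -[1+ n ] = sym (-‿involutive _)

  homomorphism : ℤ.+-*-rawRing -Raw-AlmostCommutative⟶ fromCommutativeRing R
  homomorphism = record
    { ⟦_⟧ = ⟦_⟧ ; +-homo = +-homo ; *-homo = *-homo ; -‿homo = -‿homo
    ; 0-homo = refl ; 1-homo = refl }

  equal? : ∀ i j → Maybe (⟦ i ⟧ ≈ ⟦ j ⟧)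
  equal? i j with i ℤ.≟ j
  ... | yes ≡.refl = just refl
  ... | no _ = nothing

  open import Algebra.Solver.Ring ℤ.+-*-rawRing (fromCommutativeRing R) homomorphism equal? public
    using (solve; _:+_; _:*_; _:-_; :-_; _:=_; con)

prime∤! : ∀ {p} → Prime p → ∀ {m} → m ℕ.< p → ¬ p ∣ m !
prime∤! pr {zero} _ p∣1 = ℕ.<⇒≱ (ℕ.nonTrivial⇒n>1 _ {{prime⇒nonTrivial pr}}) (∣⇒≤ p∣1)
prime∤! pr {suc m} m<p p∣m! with euclidsLemma (suc m) (m !) pr p∣m!
... | inj₁ p∣1+m = ℕ.<⇒≱ m<p (∣⇒≤ p∣1+m)
... | inj₂ p∣m! = prime∤! pr (ℕ.<-trans (ℕ.n<1+n m) m<p) p∣m!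

prime∣C : ∀ {p k} → Prime p → 0 ℕ.< k → k ℕ.< p → p ∣ p C k
prime∣C {suc p} {k} pr 0<k k<p
  with euclidsLemma (suc p C k) (k ! ℕ.* (suc p ∸ k) !) pr p∣C*k!*[p-k]!
  where
  instance _ = k ℕ.!* (suc p ∸ k) !≢0
  C*k!*[p-k]!≡p! : (suc p C k) ℕ.* (k ! ℕ.* (suc p ∸ k) !) ≡ suc p !
  C*k!*[p-k]!≡p! = ≡.trans (≡.cong (ℕ._* (k ! ℕ.* (suc p ∸ k) !)) (nCk≡n!/k![n-k]! (ℕ.<⇒≤ k<p)))
                           (m/n*n≡m (k![n∸k]!∣n! (ℕ.<⇒≤ k<p)))
  p∣C*k!*[p-k]! : suc p ∣ (suc p C k) ℕ.* (k ! ℕ.* (suc p ∸ k) !)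
  p∣C*k!*[p-k]! = ≡.subst (suc p ∣_) (≡.sym C*k!*[p-k]!≡p!) (divides (p !) (ℕ.*-comm (suc p) (p !)))
... | inj₁ p∣C = p∣C
... | inj₂ p∣k!*[p-k]! with euclidsLemma (k !) ((suc p ∸ k) !) pr p∣k!*[p-k]!
...   | inj₁ p∣k! = contradiction p∣k! (prime∤! pr k<p)
...   | inj₂ p∣[p-k]! = contradiction p∣[p-k]! (prime∤! pr (ℕ.∸-monoʳ-< 0<k (ℕ.<⇒≤ k<p)))

module FieldProperties (R : CommutativeRing 0ℓ 0ℓ) (isField : IsField R)
                       (_≟_ : Decidable (CommutativeRing._≈_ R)) where
  open CommutativeRing R
  open IsField isField
  open IntegerCoefficients R
  open import Algebra.Properties.Semiring.Mult semiring using (×1-homo-*) renaming (_×_ to _·_)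
  open import Relation.Binary.Reasoning.Setoid setoid

  x*y≈0⇒y≈0 : ∀ {x y} → x ≉ 0# → x * y ≈ 0# → y ≈ 0#
  x*y≈0⇒y≈0 {x} {y} x≉0 xy≈0 with inverse x x≉0
  ... | z , xz≈1 = begin
    y             ≈⟨ *-identityˡ y ⟨
    1# * y        ≈⟨ *-congʳ xz≈1 ⟨
    (x * z) * y   ≈⟨ solve 3 (λ x y z → (x :* z) :* y := z :* (x :* y)) refl x y z ⟩
    z * (x * y)   ≈⟨ *-congˡ xy≈0 ⟩
    z * 0#        ≈⟨ zeroʳ z ⟩
    0#            ∎

  *-≉0 : ∀ {x y} → x ≉ 0# → y ≉ 0# → x * y ≉ 0#
  *-≉0 x≉0 y≉0 xy≈0 = y≉0 (x*y≈0⇒y≈0 x≉0 xy≈0)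

  *-cancelʳ : ∀ {x y z} → z ≉ 0# → x * z ≈ y * z → x ≈ y
  *-cancelʳ {x} {y} {z} z≉0 xz≈yz = x∙y⁻¹≈ε⇒x≈y x y (x*y≈0⇒y≈0 z≉0 (begin
    z * (x - y)     ≈⟨ solve 3 (λ x y z → z :* (x :- y) := x :* z :- y :* z) refl x y z ⟩
    x * z - y * z   ≈⟨ x≈y⇒x∙y⁻¹≈ε xz≈yz ⟩
    0#              ∎))
    where open import Algebra.Properties.Group +-group using (x∙y⁻¹≈ε⇒x≈y; x≈y⇒x∙y⁻¹≈ε)

  p^m·1≈0⇒p·1≈0 : ∀ p m → (p ℕ.^ m) · 1# ≈ 0# → p · 1# ≈ 0#
  p^m·1≈0⇒p·1≈0 p zero 1≈0 = contradiction (trans (sym (+-identityʳ 1#)) 1≈0) nontrivial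
  p^m·1≈0⇒p·1≈0 p (suc m) p^[1+m]·1≈0 with ((p ℕ.^ m) · 1#) ≟ 0#
  ... | yes p^m·1≈0 = p^m·1≈0⇒p·1≈0 p m p^m·1≈0
  ... | no p^m·1≉0 = x*y≈0⇒y≈0 p^m·1≉0
          (trans (*-comm _ _) (trans (sym (×1-homo-* p (p ℕ.^ m))) p^[1+m]·1≈0))

  infix 8 _⁻¹
  -- 0# ⁻¹ is the junk value 0#.
  _⁻¹ : Carrier → Carrier
  x ⁻¹ with x ≟ 0#
  ... | yes _ = 0#
  ... | no x≉0 = proj₁ (inverse x x≉0)

  x*x⁻¹≈1 : ∀ {x} → x ≉ 0# → x * x ⁻¹ ≈ 1#
  x*x⁻¹≈1 {x} x≉0 with x ≟ 0#
  ... | yes x≈0 = contradiction x≈0 x≉0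
  ... | no x≉0′ = proj₂ (inverse x x≉0′)

  x⁻¹*x≈1 : ∀ {x} → x ≉ 0# → x ⁻¹ * x ≈ 1#
  x⁻¹*x≈1 x≉0 = trans (*-comm _ _) (x*x⁻¹≈1 x≉0)

  ⁻¹-unique : ∀ {x y} → x * y ≈ 1# → y ≈ x ⁻¹
  ⁻¹-unique {x} {y} xy≈1 = begin
    y                 ≈⟨ *-identityʳ y ⟨
    y * 1#            ≈⟨ *-congˡ (x*x⁻¹≈1 x≉0) ⟨
    y * (x * x ⁻¹)    ≈⟨ solve 3 (λ x y z → y :* (x :* z) := (x :* y) :* z) refl x y (x ⁻¹) ⟩
    (x * y) * x ⁻¹    ≈⟨ *-congʳ xy≈1 ⟩
    1# * x ⁻¹         ≈⟨ *-identityˡ _ ⟩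
    x ⁻¹              ∎
    where
    x≉0 : x ≉ 0#
    x≉0 x≈0 = nontrivial (trans (sym xy≈1) (trans (*-congʳ x≈0) (zeroˡ y)))

  ⁻¹-cong : ∀ {x y} → x ≉ 0# → x ≈ y → x ⁻¹ ≈ y ⁻¹
  ⁻¹-cong x≉0 x≈y = ⁻¹-unique (trans (*-congʳ (sym x≈y)) (x*x⁻¹≈1 x≉0))

  ⁻¹-≉0 : ∀ {x} → x ≉ 0# → x ⁻¹ ≉ 0#
  ⁻¹-≉0 {x} x≉0 x⁻¹≈0 = nontrivial (trans (sym (x*x⁻¹≈1 x≉0)) (trans (*-congˡ x⁻¹≈0) (zeroʳ x)))

  cross-multiplication : ∀ {a b u v} → u ≉ 0# → v ≉ 0# → a * v ≈ b * u → a * u ⁻¹ ≈ b * v ⁻¹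
  cross-multiplication {a} {b} {u} {v} u≉0 v≉0 av≈bu = begin
    a * u ⁻¹
      ≈⟨ *-identityʳ _ ⟨
    a * u ⁻¹ * 1#
      ≈⟨ *-congˡ (x*x⁻¹≈1 v≉0) ⟨
    a * u ⁻¹ * (v * v ⁻¹)
      ≈⟨ solve 4 (λ a u′ v v′ → a :* u′ :* (v :* v′) := (a :* v) :* (u′ :* v′)) refl a (u ⁻¹) v (v ⁻¹) ⟩
    (a * v) * (u ⁻¹ * v ⁻¹)
      ≈⟨ *-congʳ av≈bu ⟩
    (b * u) * (u ⁻¹ * v ⁻¹)
      ≈⟨ solve 4 (λ b u u′ v′ → (b :* u) :* (u′ :* v′) := b :* v′ :* (u :* u′)) refl b u (u ⁻¹) (v ⁻¹) ⟩
    b * v ⁻¹ * (u * u ⁻¹)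
      ≈⟨ *-congˡ (x*x⁻¹≈1 u≉0) ⟩
    b * v ⁻¹ * 1#
      ≈⟨ *-identityʳ _ ⟩
    b * v ⁻¹ ∎

module Frobenius (R : CommutativeRing 0ℓ 0ℓ) {p} (pr : Prime p) where
  open CommutativeRing R
  open IntegerCoefficients R
  open import Algebra.Properties.Semiring.Mult semiring using (×-assoc-*; ×1-homo-*; ×-congʳ) renaming (_×_ to _·_)
  open import Algebra.Properties.Semiring.Exp semiring using (_^_; ^-congˡ; ^-assocʳ)
  open import Algebra.Properties.CommutativeSemiring.Binomial commutativeSemiring using (theorem; binomialTerm; binomial)
  open import Algebra.Properties.Semiring.Sum semiring using (sum; sum-init-last; sum-cong-≋; sum-replicate-zero)
  open import Relation.Binary.Reasoning.Setoid setoid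

  module _ (char : p · 1# ≈ 0#) where

    ·-char : ∀ {c} x → p ∣ c → c · x ≈ 0#
    ·-char {c} x (divides d ≡.refl) = begin
      (d ℕ.* p) · x               ≈⟨ ×-congʳ (d ℕ.* p) (*-identityˡ x) ⟨
      (d ℕ.* p) · (1# * x)        ≈⟨ ×-assoc-* (d ℕ.* p) 1# x ⟨
      ((d ℕ.* p) · 1#) * x        ≈⟨ *-congʳ (×1-homo-* d p) ⟩
      ((d · 1#) * (p · 1#)) * x   ≈⟨ *-congʳ (trans (*-congˡ char) (zeroʳ _)) ⟩
      0# * x                      ≈⟨ zeroˡ x ⟩
      0#                          ∎

    ^-+-homo : ∀ P → 1 ℕ.< P → (∀ c → 0 ℕ.< c → c ℕ.< P → p ∣ P C c) →
               ∀ x y → (x + y) ^ P ≈ x ^ P + y ^ P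
    ^-+-homo (suc zero) (ℕ.s≤s ()) _
    ^-+-homo (suc (suc m)) _ p∣PCc x y = begin
      (x + y) ^ P
        ≈⟨ theorem P x y ⟩
      t Fin.zero + sum (λ i → t (Fin.suc i))
        ≈⟨ +-congˡ (sum-init-last (λ i → t (Fin.suc i))) ⟩
      t Fin.zero + (sum (λ j → t (Fin.suc (inject₁ j))) + t (fromℕ P))
        ≈⟨ +-cong first (+-cong inner last) ⟩
      y ^ P + (0# + x ^ P)
        ≈⟨ solve 2 (λ a b → b :+ (con (+ 0) :+ a) := a :+ b) refl (x ^ P) (y ^ P) ⟩
      x ^ P + y ^ P ∎
      where
      P = suc (suc m)
      t = binomialTerm x y P
      first : t Fin.zero ≈ y ^ P
      first = trans (+-identityʳ _) (*-identityˡ _)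
      last : t (fromℕ P) ≈ x ^ P
      last = begin
        t (fromℕ P)                                ≡⟨ ≡.cong (λ c → (P C c) · (x ^ c * y ^ (P ∸ c))) (Fin.toℕ-fromℕ P) ⟩
        (P C P) · (x ^ P * y ^ (P ∸ P))            ≡⟨ ≡.cong₂ (λ c d → c · (x ^ P * y ^ d)) (nCn≡1 P) (ℕ.n∸n≡0 P) ⟩
        1 · (x ^ P * 1#)                           ≈⟨ trans (+-identityʳ _) (*-identityʳ _) ⟩
        x ^ P                                      ∎
      inner : sum (λ j → t (Fin.suc (inject₁ j))) ≈ 0#
      inner = trans (sum-cong-≋ vanishes) (sum-replicate-zero (suc m))
        where
        vanishes : ∀ j → t (Fin.suc (inject₁ j)) ≈ 0#
        vanishes j = ·-char (binomial x y P (Fin.suc (inject₁ j)))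
          (≡.subst (λ c → p ∣ P C c) (≡.cong suc (≡.sym (Fin.toℕ-inject₁ j)))
                   (p∣PCc (suc (toℕ j)) (ℕ.s≤s ℕ.z≤n) (ℕ.s≤s (Fin.toℕ<n j))))

    ^p-+ : ∀ x y → (x + y) ^ p ≈ x ^ p + y ^ p
    ^p-+ = ^-+-homo p (ℕ.nonTrivial⇒n>1 p {{prime⇒nonTrivial pr}}) (λ c → prime∣C pr)

    ^p^j-+ : ∀ j x y → (x + y) ^ (p ℕ.^ j) ≈ x ^ (p ℕ.^ j) + y ^ (p ℕ.^ j)
    ^p^j-+ zero x y = distribʳ 1# x y
    ^p^j-+ (suc j) x y = begin
      (x + y) ^ (p ℕ.* p ℕ.^ j)                     ≈⟨ ^-assocʳ (x + y) p (p ℕ.^ j) ⟨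
      ((x + y) ^ p) ^ (p ℕ.^ j)                     ≈⟨ ^-congˡ (p ℕ.^ j) (^p-+ x y) ⟩
      (x ^ p + y ^ p) ^ (p ℕ.^ j)                   ≈⟨ ^p^j-+ j (x ^ p) (y ^ p) ⟩
      (x ^ p) ^ (p ℕ.^ j) + (y ^ p) ^ (p ℕ.^ j)     ≈⟨ +-cong (^-assocʳ x p (p ℕ.^ j)) (^-assocʳ y p (p ℕ.^ j)) ⟩
      x ^ (p ℕ.* p ℕ.^ j) + y ^ (p ℕ.* p ℕ.^ j)     ∎

Searchable² : Setoid 0ℓ 0ℓ → Set₁
Searchable² S = (P : Carrier → Carrier → Set) → (∀ x y → Dec (P x y)) →
                (∀ {x x′ y y′} → x ≈ x′ → y ≈ y′ → P x y → P x′ y′) →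
                (∃₂ P) ⊎ (∀ x y → ¬ P x y)
  where open Setoid S

module FiniteSetoid {n} {S : Setoid 0ℓ 0ℓ} (enumeration : Bijection (≡.setoid (Fin n)) S) where
  open Setoid S
  private module E = Inverse (Bijection⇒Inverse enumeration)

  element : Fin n → Carrier
  element = E.to

  index : Carrier → Fin n
  index = E.from

  element-index : ∀ x → element (index x) ≈ x
  element-index x = E.inverseˡ ≡.refl

  index-element : ∀ i → index (element i) ≡ i
  index-element i = E.inverseʳ refl

  index-cong : ∀ {x y} → x ≈ y → index x ≡ index y
  index-cong = E.from-cong

  infix 4 _≟_
  _≟_ : Decidable _≈_
  x ≟ y with index x Fin.≟ index y
  ... | yes i≡j = yes (trans (sym (element-index x)) (trans (reflexive (≡.cong element i≡j)) (element-index y)))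
  ... | no i≢j = no (i≢j ∘ index-cong)

  search² : Searchable² S
  search² P P? resp with Fin.any? (λ i → Fin.any? (λ j → P? (element i) (element j)))
  ... | yes (i , j , Pij) = inj₁ (element i , element j , Pij)
  ... | no ¬Pij = inj₂ λ x y Pxy →
          ¬Pij (index x , index y , resp (sym (element-index x)) (sym (element-index y)) Pxy)

module FiniteSum (M : CommutativeMonoid 0ℓ 0ℓ) {n}
                 (enumeration : Bijection (≡.setoid (Fin n)) (CommutativeMonoid.setoid M)) where
  open CommutativeMonoid M
  open FiniteSetoid enumeration
  open import Algebra.Properties.CommutativeMonoid.Sum M
  open import Algebra.Definitions.RawMonoid rawMonoid using () renaming (_×_ to _·_)
  open import Relation.Binary.Reasoning.Setoid setoid

  ∑ : (Carrier → Carrier) → Carrier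
  ∑ f = sum (f ∘ element)

  ∑-cong : ∀ {f g} → (∀ x → f x ≈ g x) → ∑ f ≈ ∑ g
  ∑-cong f≈g = sum-cong-≋ (f≈g ∘ element)

  ∑-reindex : (π : Inverse setoid setoid) → ∀ {f} → (∀ {x y} → x ≈ y → f x ≈ f y) →
              ∑ f ≈ ∑ (f ∘ Inverse.to π)
  ∑-reindex π {f} f-cong = trans (sum-permute (f ∘ element) permutation)
    (∑-cong (λ x → f-cong (element-index (Inverse.to π x))))
    where
    permutation : Inverse (≡.setoid (Fin n)) (≡.setoid (Fin n))
    permutation = Composition.inverse (Bijection⇒Inverse enumeration)
                    (Composition.inverse π (Symmetry.inverse (Bijection⇒Inverse enumeration)))

  ∑-const : ∀ x → ∑ (λ _ → x) ≈ n · x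
  ∑-const x = sum-replicate n

  ∑-distrib : ∀ f g → ∑ (λ x → f x ∙ g x) ≈ ∑ f ∙ ∑ g
  ∑-distrib f g = ∑-distrib-+ (f ∘ element) (g ∘ element)

  ∑-closed : (P : Carrier → Set) → P ε → (∀ {x y} → P x → P y → P (x ∙ y)) →
             ∀ {f} → (∀ x → P (f x)) → P (∑ f)
  ∑-closed P Pε P∙ {f} Pf = sum-closed (f ∘ element) (Pf ∘ element)
    where
    sum-closed : ∀ {m} (v : Fin m → Carrier) → (∀ i → P (v i)) → P (sum v)
    sum-closed {zero} v Pv = Pε
    sum-closed {suc m} v Pv = P∙ (Pv Fin.zero) (sum-closed (v ∘ Fin.suc) (Pv ∘ Fin.suc))

  sum-δ : ∀ {m} (v : Fin m → Carrier) i₀ → (∀ i → i ≢ i₀ → v i ≈ ε) → sum v ≈ v i₀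
  sum-δ {suc m} v i₀ v≈ε = begin
    sum v                         ≈⟨ sum-remove {i = i₀} v ⟩
    v i₀ ∙ sum (v ∘ punchIn i₀)   ≈⟨ ∙-congˡ (sum-cong-≋ (λ j → v≈ε (punchIn i₀ j) (Fin.punchInᵢ≢i i₀ j))) ⟩
    v i₀ ∙ sum {m} (λ _ → ε)      ≈⟨ ∙-congˡ (sum-replicate-zero m) ⟩
    v i₀ ∙ ε                      ≈⟨ identityʳ _ ⟩
    v i₀                          ∎

  ∑-δ : ∀ f x₀ → (∀ {x y} → x ≈ y → f x ≈ f y) → (∀ x → ¬ x ≈ x₀ → f x ≈ ε) → ∑ f ≈ f x₀
  ∑-δ f x₀ f-cong f≈ε = trans (sum-δ (f ∘ element) (index x₀) (λ i i≢i₀ → f≈ε (element i) (i≢i₀ ∘ element≈⇒≡)))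
                              (f-cong (element-index x₀))
    where
    element≈⇒≡ : ∀ {i} → element i ≈ x₀ → i ≡ index x₀
    element≈⇒≡ {i} eq = ≡.trans (≡.sym (index-element i)) (index-cong eq)

module FiniteField (R : CommutativeRing 0ℓ 0ℓ) (isField : IsField R) {n} (size : HasSize R n) where
  open CommutativeRing R
  open IsField isField
  open FiniteSetoid size public using (_≟_; search²)
  open FieldProperties R isField _≟_
  open IntegerCoefficients R
  open import Algebra.Properties.Semiring.Mult semiring using () renaming (_×_ to _·_)
  open import Algebra.Properties.Semiring.Exp semiring using (_^_)
  open import Algebra.Properties.Group +-group using (identityʳ-unique)
  open import Relation.Binary.Reasoning.Setoid setoid
  module + = FiniteSum +-commutativeMonoid size
  module * = FiniteSum *-commutativeMonoid size

  translation : Carrier → Inverse setoid setoid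
  translation a = record
    { to = _+ a ; from = _- a ; to-cong = +-congʳ ; from-cong = +-congʳ
    ; inverse = (λ {x} {y} y≈x-a → trans (+-congʳ y≈x-a) (solve 2 (λ x a → (x :- a) :+ a := x) refl x a))
              , (λ {x} {y} y≈x+a → trans (+-congʳ y≈x+a) (solve 2 (λ x a → (x :+ a) :- a := x) refl x a)) }

  scaling : ∀ {a} → a ≉ 0# → Inverse setoid setoid
  scaling {a} a≉0 = record
    { to = a *_ ; from = a ⁻¹ *_ ; to-cong = *-congˡ ; from-cong = *-congˡ
    ; inverse = (λ {x} {y} y≈a⁻¹x → trans (*-congˡ y≈a⁻¹x) (cancel (x*x⁻¹≈1 a≉0)))
              , (λ {x} {y} y≈ax → trans (*-congˡ y≈ax) (cancel (x⁻¹*x≈1 a≉0))) }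
    where
    cancel : ∀ {b c x} → b * c ≈ 1# → b * (c * x) ≈ x
    cancel {b} {c} {x} bc≈1 = trans (sym (*-assoc b c x)) (trans (*-congʳ bc≈1) (*-identityˡ x))

  n·x≈0 : ∀ x → n · x ≈ 0#
  n·x≈0 x = identityʳ-unique (+.∑ (λ y → y)) (n · x) (sym (begin
    +.∑ (λ y → y)                  ≈⟨ +.∑-reindex (translation x) (λ y≈z → y≈z) ⟩
    +.∑ (λ y → y + x)              ≈⟨ +.∑-distrib (λ y → y) (λ _ → x) ⟩
    +.∑ (λ y → y) + +.∑ (λ _ → x)  ≈⟨ +-congˡ (+.∑-const x) ⟩
    +.∑ (λ y → y) + n · x          ∎))

  if0 : Carrier → Carrier → Carrier → Carrier
  if0 y u v with y ≟ 0#
  ... | yes _ = u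
  ... | no _ = v

  if0-zero : ∀ {y} u v → y ≈ 0# → if0 y u v ≈ u
  if0-zero {y} u v y≈0 with y ≟ 0#
  ... | yes _ = refl
  ... | no y≉0 = contradiction y≈0 y≉0

  if0-nonzero : ∀ {y} u v → y ≉ 0# → if0 y u v ≈ v
  if0-nonzero {y} u v y≉0 with y ≟ 0#
  ... | yes y≈0 = contradiction y≈0 y≉0
  ... | no _ = refl

  if0-cong : ∀ {y y′ u u′ v v′} → y ≈ y′ → u ≈ u′ → v ≈ v′ → if0 y u v ≈ if0 y′ u′ v′
  if0-cong {y} y≈y′ u≈u′ v≈v′ with y ≟ 0#
  ... | yes y≈0 = trans u≈u′ (sym (if0-zero _ _ (trans (sym y≈y′) y≈0)))
  ... | no y≉0 = trans v≈v′ (sym (if0-nonzero _ _ (y≉0 ∘ trans y≈y′)))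

  -- Multiplication by a permutes the field. With h replacing 0 by 1, the product of all h y is
  -- nonzero, and a * h y = h (a * y) except at y = 0, where the correction factor k y = a enters.
  x^n≈x : ∀ x → x ≉ 0# → x ^ n ≈ x
  x^n≈x a a≉0 = *-cancelʳ ∏h≉0 (begin
    a ^ n * *.∑ h                      ≈⟨ *-congʳ (*.∑-const a) ⟨
    *.∑ (λ _ → a) * *.∑ h              ≈⟨ *.∑-distrib (λ _ → a) h ⟨
    *.∑ (λ y → a * h y)                ≈⟨ *.∑-cong a*h≈h[a*]*k ⟩
    *.∑ (λ y → h (a * y) * k y)        ≈⟨ *.∑-distrib (h ∘ (a *_)) k ⟩
    *.∑ (h ∘ (a *_)) * *.∑ k           ≈⟨ *-cong (sym (*.∑-reindex (scaling a≉0) h-cong)) (*.∑-δ k 0# k-cong k≈1) ⟩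
    *.∑ h * k 0#                       ≈⟨ *-congˡ (if0-zero a 1# refl) ⟩
    *.∑ h * a                          ≈⟨ *-comm _ _ ⟩
    a * *.∑ h                          ∎)
    where
    h k : Carrier → Carrier
    h y = if0 y 1# y
    k y = if0 y a 1#

    h-cong : ∀ {x y} → x ≈ y → h x ≈ h y
    h-cong x≈y = if0-cong x≈y refl x≈y

    k-cong : ∀ {x y} → x ≈ y → k x ≈ k y
    k-cong x≈y = if0-cong x≈y refl refl

    k≈1 : ∀ y → y ≉ 0# → k y ≈ 1#
    k≈1 y = if0-nonzero a 1#

    ∏h≉0 : *.∑ h ≉ 0#
    ∏h≉0 = *.∑-closed (_≉ 0#) nontrivial *-≉0 h≉0
      where
      h≉0 : ∀ y → h y ≉ 0#
      h≉0 y with y ≟ 0#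
      ... | yes _ = nontrivial
      ... | no y≉0 = y≉0

    a*h≈h[a*]*k : ∀ y → a * h y ≈ h (a * y) * k y
    a*h≈h[a*]*k y with y ≟ 0#
    ... | yes y≈0 = begin
      a * 1#                 ≈⟨ *-comm a 1# ⟩
      1# * a                 ≈⟨ *-congʳ (if0-zero 1# (a * y) (trans (*-congˡ y≈0) (zeroʳ a))) ⟨
      h (a * y) * a          ∎
    ... | no y≉0 = begin
      a * y                  ≈⟨ *-identityʳ _ ⟨
      (a * y) * 1#           ≈⟨ *-congʳ (if0-nonzero 1# (a * y) (*-≉0 a≉0 y≉0)) ⟨
      h (a * y) * 1#         ∎

record IsInvolutiveAutomorphism (R : CommutativeRing 0ℓ 0ℓ)
         (σ : CommutativeRing.Carrier R → CommutativeRing.Carrier R) : Set where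
  open CommutativeRing R
  field
    cong       : ∀ {x y} → x ≈ y → σ x ≈ σ y
    +-homo     : ∀ x y → σ (x + y) ≈ σ x + σ y
    *-homo     : ∀ x y → σ (x * y) ≈ σ x * σ y
    1#-homo    : σ 1# ≈ 1#
    involutive : ∀ x → σ (σ x) ≈ x

frobeniusInvolution : ∀ {p k} → Prime p → (R : CommutativeRing 0ℓ 0ℓ) → IsField R →
                      let q = p ℕ.^ suc k in HasSize R (q ℕ.* q) →
                      IsInvolutiveAutomorphism R (λ x → PL.pow R q x q)
frobeniusInvolution {p} {k} pr R isField size = record
  { cong = λ x≈y → trans (pow≈^ _ q) (trans (^-congˡ q x≈y) (sym (pow≈^ _ q)))
  ; +-homo = λ x y → trans (pow≈^ (x + y) q) (trans (^p^j-+ char (suc k) x y)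
                       (sym (+-cong (pow≈^ x q) (pow≈^ y q))))
  ; *-homo = λ x y → trans (pow≈^ (x * y) q) (trans (^-distrib-* x y q)
                       (sym (*-cong (pow≈^ x q) (pow≈^ y q))))
  ; 1#-homo = pow-1# q
  ; involutive = involutive
  }
  where
  q = p ℕ.^ suc k
  open CommutativeRing R
  open PL R q using (pow)
  open FiniteField R isField size
  open FieldProperties R isField _≟_ using (p^m·1≈0⇒p·1≈0)
  open Frobenius R pr using (^p^j-+)
  open import Algebra.Properties.Semiring.Exp semiring using (_^_; ^-congˡ; ^-assocʳ)
  open import Algebra.Properties.CommutativeSemiring.Exp commutativeSemiring using (^-distrib-*)
  open import Algebra.Properties.Semiring.Mult semiring using () renaming (_×_ to _·_)

  pow≈^ : ∀ x m → pow x m ≈ x ^ m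
  pow≈^ x zero = refl
  pow≈^ x (suc m) = *-congˡ (pow≈^ x m)

  pow-1# : ∀ m → pow 1# m ≈ 1#
  pow-1# zero = refl
  pow-1# (suc m) = trans (*-identityˡ _) (pow-1# m)

  char : p · 1# ≈ 0#
  char = p^m·1≈0⇒p·1≈0 p (suc k ℕ.+ suc k)
           (trans (reflexive (≡.cong (_· 1#) (ℕ.^-distribˡ-+-* p (suc k) (suc k)))) (n·x≈0 1#))

  x^[q*q]≈x : ∀ x → x ^ (q ℕ.* q) ≈ x
  x^[q*q]≈x x with x ≟ 0#
  ... | no x≉0 = x^n≈x x x≉0
  ... | yes x≈0 = trans (^-congˡ (q ℕ.* q) x≈0) (trans (0^m≈0 (q ℕ.* q)) (sym x≈0))
    where
    instance
      _ = prime⇒nonZero pr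
      _ = ℕ.m^n≢0 p (suc k)
      _ = ℕ.m*n≢0 q q
    0^m≈0 : ∀ m → .{{ℕ.NonZero m}} → 0# ^ m ≈ 0#
    0^m≈0 (suc m) = zeroˡ _

  involutive : ∀ x → pow (pow x q) q ≈ x
  involutive x = trans (pow≈^ _ q) (trans (^-congˡ q (pow≈^ x q)) (trans (^-assocʳ x q q) (x^[q*q]≈x x)))

module ProjectiveLine (R : CommutativeRing 0ℓ 0ℓ) (isField : IsField R)
                      (_≟_ : Decidable (CommutativeRing._≈_ R)) (q : ℕ) where
  open CommutativeRing R
  open IsField isField
  open FieldProperties R isField _≟_
  open IntegerCoefficients R
  open PL R q
  open import Algebra.Properties.Ring ring using (-0#≈0#; -‿involutive; -‿distribʳ-*)
  open import Algebra.Properties.Group +-group using (x∙y⁻¹≈ε⇒x≈y; x≈y⇒x∙y⁻¹≈ε)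
  open import Relation.Binary.Reasoning.Setoid setoid

  module V = Setoid (×-setoid setoid setoid)

  infix 4 _≋_
  _≋_ : V2 → V2 → Set
  _≋_ = V._≈_

  infixl 7 _⊛_
  infixl 6 _⊕_

  _⊛_ : Carrier → V2 → V2
  c ⊛ (x , y) = (c * x , c * y)

  _⊕_ : V2 → V2 → V2
  (a , b) ⊕ (c , d) = (a + c , b + d)

  det₂ : V2 → V2 → Carrier
  det₂ (a , b) (c , d) = a * d - b * c

  ∼⇒det₂≈0 : ∀ {u v} → u ∼ v → det₂ u v ≈ 0#
  ∼⇒det₂≈0 = x≈y⇒x∙y⁻¹≈ε

  det₂≈0⇒∼ : ∀ {u v} → det₂ u v ≈ 0# → u ∼ v
  det₂≈0⇒∼ = x∙y⁻¹≈ε⇒x≈y _ _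

  det₂-cong : ∀ {u u′ v v′} → u ≋ u′ → v ≋ v′ → det₂ u v ≈ det₂ u′ v′
  det₂-cong (a≈ , b≈) (c≈ , d≈) = +-cong (*-cong a≈ d≈) (-‿cong (*-cong b≈ c≈))

  det₂-antisym : ∀ u v → det₂ u v ≈ - det₂ v u
  det₂-antisym (a , b) (c , d) = solve 4 (λ a b c d → a :* d :- b :* c := :- (c :* b :- d :* a)) refl a b c d

  det₂-⊛ˡ : ∀ c u v → det₂ (c ⊛ u) v ≈ c * det₂ u v
  det₂-⊛ˡ c (a , b) (x , y) = solve 5 (λ c a b x y → c :* a :* y :- c :* b :* x := c :* (a :* y :- b :* x)) refl c a b x y

  det₂-⊛ : ∀ c u v → det₂ (c ⊛ u) (c ⊛ v) ≈ (c * c) * det₂ u v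
  det₂-⊛ c (a , b) (x , y) = solve 5 (λ c a b x y → c :* a :* (c :* y) :- c :* b :* (c :* x) := c :* c :* (a :* y :- b :* x)) refl c a b x y

  det₂-bilinear : ∀ s t u u′ v v′ → det₂ (s ⊛ u ⊕ t ⊛ v) (s ⊛ u′ ⊕ t ⊛ v′) ≈
                  (s * s) * det₂ u u′ + (s * t) * (det₂ u v′ + det₂ v u′) + (t * t) * det₂ v v′
  det₂-bilinear s t (a , b) (a′ , b′) (c , d) (c′ , d′) = solve 10 (λ s t a b a′ b′ c d c′ d′ →
      (s :* a :+ t :* c) :* (s :* b′ :+ t :* d′) :- (s :* b :+ t :* d) :* (s :* a′ :+ t :* c′)
      := (s :* s) :* (a :* b′ :- b :* a′) :+ (s :* t) :* ((a :* d′ :- b :* c′) :+ (c :* b′ :- d :* a′))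
         :+ (t :* t) :* (c :* d′ :- d :* c′))
    refl s t a b a′ b′ c d c′ d′

  det₂-decomposition : ∀ u v w → det₂ u v ⊛ w ≋ det₂ w v ⊛ u ⊕ det₂ u w ⊛ v
  det₂-decomposition (a , b) (c , d) (x , y) =
    solve 6 (λ a b c d x y → (a :* d :- b :* c) :* x := (x :* d :- y :* c) :* a :+ (a :* y :- b :* x) :* c) refl a b c d x y ,
    solve 6 (λ a b c d x y → (a :* d :- b :* c) :* y := (x :* d :- y :* c) :* b :+ (a :* y :- b :* x) :* d) refl a b c d x y

  det₂-shearˡ : ∀ s u v → det₂ u (s ⊛ u ⊕ v) ≈ det₂ u v
  det₂-shearˡ s (a , b) (c , d) = solve 5 (λ s a b c d → a :* (s :* b :+ d) :- b :* (s :* a :+ c) := a :* d :- b :* c) refl s a b c d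

  det₂-shearʳ : ∀ s u v → det₂ (s ⊛ u ⊕ v) v ≈ s * det₂ u v
  det₂-shearʳ s (a , b) (c , d) = solve 5 (λ s a b c d → (s :* a :+ c) :* d :- (s :* b :+ d) :* c := s :* (a :* d :- b :* c)) refl s a b c d

  det₂-shear : ∀ s u v w → det₂ w (s ⊛ u ⊕ v) ≈ det₂ w v - det₂ u w * s
  det₂-shear s (a , b) (c , d) (x , y) = solve 7 (λ s a b c d x y →
    x :* (s :* b :+ d) :- y :* (s :* a :+ c) := (x :* d :- y :* c) :- (a :* y :- b :* x) :* s) refl s a b c d x y

  det₂≉0⇒nonzeroʳ : ∀ {u v} → det₂ u v ≉ 0# → NonZeroV v
  det₂≉0⇒nonzeroʳ {a , b} {c , d} det≉0 (c≈0 , d≈0) = det≉0 (begin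
    a * d - b * c    ≈⟨ +-cong (*-congˡ d≈0) (-‿cong (*-congˡ c≈0)) ⟩
    a * 0# - b * 0#  ≈⟨ solve 2 (λ a b → a :* con (+ 0) :- b :* con (+ 0) := con (+ 0)) refl a b ⟩
    0#               ∎)

  ∼-refl : ∀ {u} → u ∼ u
  ∼-refl {a , b} = *-comm a b

  ∼-sym : ∀ {u v} → u ∼ v → v ∼ u
  ∼-sym {a , b} {c , d} ad≈bc = trans (*-comm c b) (trans (sym ad≈bc) (*-comm a d))

  ∼-trans : ∀ {u v w} → NonZeroV v → u ∼ v → v ∼ w → u ∼ w
  ∼-trans {a , b} {c , d} {e , f} v≢0 u∼v v∼w with d ≟ 0#
  ... | no d≉0 = det₂≈0⇒∼ (x*y≈0⇒y≈0 d≉0 (begin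
    d * (a * f - b * e)
      ≈⟨ solve 6 (λ a b c d e f → d :* (a :* f :- b :* e) := f :* (a :* d :- b :* c) :+ b :* (c :* f :- d :* e)) refl a b c d e f ⟩
    f * det₂ (a , b) (c , d) + b * det₂ (c , d) (e , f)
      ≈⟨ +-cong (*-congˡ (∼⇒det₂≈0 u∼v)) (*-congˡ (∼⇒det₂≈0 v∼w)) ⟩
    f * 0# + b * 0#
      ≈⟨ trans (+-cong (zeroʳ f) (zeroʳ b)) (+-identityˡ 0#) ⟩
    0# ∎))
  ... | yes d≈0 = det₂≈0⇒∼ (x*y≈0⇒y≈0 c≉0 (begin
    c * (a * f - b * e)
      ≈⟨ solve 6 (λ a b c d e f → c :* (a :* f :- b :* e) := a :* (c :* f :- d :* e) :+ e :* (a :* d :- b :* c)) refl a b c d e f ⟩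
    a * det₂ (c , d) (e , f) + e * det₂ (a , b) (c , d)
      ≈⟨ +-cong (*-congˡ (∼⇒det₂≈0 v∼w)) (*-congˡ (∼⇒det₂≈0 u∼v)) ⟩
    a * 0# + e * 0#
      ≈⟨ trans (+-cong (zeroʳ a) (zeroʳ e)) (+-identityˡ 0#) ⟩
    0# ∎))
    where
    c≉0 : c ≉ 0#
    c≉0 c≈0 = v≢0 (c≈0 , d≈0)

  ∼-resp-≋ : ∀ {u u′ v v′} → u ≋ u′ → v ≋ v′ → u ∼ v → u′ ∼ v′
  ∼-resp-≋ (a≈ , b≈) (c≈ , d≈) ad≈bc = trans (*-cong (sym a≈) (sym d≈)) (trans ad≈bc (*-cong b≈ c≈))

  ≋⇒∼ : ∀ {u v} → u ≋ v → u ∼ v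
  ≋⇒∼ u≋v = ∼-resp-≋ V.refl u≋v ∼-refl

  nonzero-resp-≋ : ∀ {u v} → u ≋ v → NonZeroV u → NonZeroV v
  nonzero-resp-≋ (a≈ , b≈) u≢0 (c≈0 , d≈0) = u≢0 (trans a≈ c≈0 , trans b≈ d≈0)

  ⊛-∼ : ∀ c v → (c ⊛ v) ∼ v
  ⊛-∼ c (x , y) = solve 3 (λ c x y → c :* x :* y := c :* y :* x) refl c x y

  ⊛-nonzero : ∀ {c v} → c ≉ 0# → NonZeroV v → NonZeroV (c ⊛ v)
  ⊛-nonzero c≉0 v≢0 (cx≈0 , cy≈0) = v≢0 (x*y≈0⇒y≈0 c≉0 cx≈0 , x*y≈0⇒y≈0 c≉0 cy≈0)

  apply-cong : ∀ M {u v} → u ≋ v → apply M u ≋ apply M v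
  apply-cong (mat a b c d) (x≈ , y≈) = +-cong (*-congˡ x≈) (*-congˡ y≈) , +-cong (*-congˡ x≈) (*-congˡ y≈)

  apply-⊛ : ∀ M c v → apply M (c ⊛ v) ≋ c ⊛ apply M v
  apply-⊛ (mat a b c d) s (x , y) =
    solve 5 (λ a b s x y → a :* (s :* x) :+ b :* (s :* y) := s :* (a :* x :+ b :* y)) refl a b s x y ,
    solve 5 (λ a b s x y → a :* (s :* x) :+ b :* (s :* y) := s :* (a :* x :+ b :* y)) refl c d s x y

  apply-⊕ : ∀ M u v → apply M (u ⊕ v) ≋ apply M u ⊕ apply M v
  apply-⊕ (mat a b c d) (x , y) (z , w) =
    solve 6 (λ a b x y z w → a :* (x :+ z) :+ b :* (y :+ w) := (a :* x :+ b :* y) :+ (a :* z :+ b :* w)) refl a b x y z w ,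
    solve 6 (λ a b x y z w → a :* (x :+ z) :+ b :* (y :+ w) := (a :* x :+ b :* y) :+ (a :* z :+ b :* w)) refl c d x y z w

  ⊛-cong : ∀ c {u v} → u ≋ v → c ⊛ u ≋ c ⊛ v
  ⊛-cong c (x≈ , y≈) = *-congˡ x≈ , *-congˡ y≈

  ⊕-cong : ∀ {u u′ v v′} → u ≋ u′ → v ≋ v′ → u ⊕ v ≋ u′ ⊕ v′
  ⊕-cong (a≈ , b≈) (c≈ , d≈) = +-cong a≈ c≈ , +-cong b≈ d≈

  ⊛-assoc : ∀ s t v → s ⊛ (t ⊛ v) ≋ (s * t) ⊛ v
  ⊛-assoc s t (x , y) = sym (*-assoc s t x) , sym (*-assoc s t y)

  apply-det₂ : ∀ M u v → det₂ (apply M u) (apply M v) ≈ det M * det₂ u v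
  apply-det₂ (mat a b c d) (x , y) (z , w) = solve 8 (λ a b c d x y z w →
    (a :* x :+ b :* y) :* (c :* z :+ d :* w) :- (c :* x :+ d :* y) :* (a :* z :+ b :* w)
    := (a :* d :+ :- (b :* c)) :* (x :* w :- y :* z)) refl a b c d x y z w

  ∼-apply : ∀ M {u v} → u ∼ v → apply M u ∼ apply M v
  ∼-apply M {u} {v} u∼v = det₂≈0⇒∼ (trans (apply-det₂ M u v) (trans (*-congˡ (∼⇒det₂≈0 u∼v)) (zeroʳ _)))

  adj : Mat → Mat
  adj (mat a b c d) = mat d (- b) (- c) a

  det-adj : ∀ M → det (adj M) ≈ det M
  det-adj (mat a b c d) = solve 4 (λ a b c d → d :* a :+ :- (:- b :* :- c) := a :* d :+ :- (b :* c)) refl a b c d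

  apply-adj-apply : ∀ M v → apply (adj M) (apply M v) ≋ det M ⊛ v
  apply-adj-apply (mat a b c d) (x , y) =
    solve 6 (λ a b c d x y → d :* (a :* x :+ b :* y) :+ :- b :* (c :* x :+ d :* y) := (a :* d :+ :- (b :* c)) :* x) refl a b c d x y ,
    solve 6 (λ a b c d x y → :- c :* (a :* x :+ b :* y) :+ a :* (c :* x :+ d :* y) := (a :* d :+ :- (b :* c)) :* y) refl a b c d x y

  apply-apply-adj : ∀ M v → apply M (apply (adj M) v) ≋ det M ⊛ v
  apply-apply-adj (mat a b c d) (x , y) =
    solve 6 (λ a b c d x y → a :* (d :* x :+ :- b :* y) :+ b :* (:- c :* x :+ a :* y) := (a :* d :+ :- (b :* c)) :* x) refl a b c d x y ,
    solve 6 (λ a b c d x y → c :* (d :* x :+ :- b :* y) :+ d :* (:- c :* x :+ a :* y) := (a :* d :+ :- (b :* c)) :* y) refl a b c d x y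

  apply-nonzero : ∀ M {v} → det M ≉ 0# → NonZeroV v → NonZeroV (apply M v)
  apply-nonzero M {v} det≉0 v≢0 Mv≈0 =
    ⊛-nonzero det≉0 v≢0 (V.trans (V.sym (apply-adj-apply M v)) (apply-zero (adj M) Mv≈0))
    where
    apply-zero : ∀ M {u} → u ≋ (0# , 0#) → apply M u ≋ (0# , 0#)
    apply-zero (mat a b c d) {x , y} (x≈0 , y≈0) = vanish a b , vanish c d
      where
      vanish : ∀ a b → a * x + b * y ≈ 0#
      vanish a b = trans (+-cong (trans (*-congˡ x≈0) (zeroʳ a)) (trans (*-congˡ y≈0) (zeroʳ b))) (+-identityˡ 0#)

  infixl 7 _⊙_
  _⊙_ : Mat → Mat → Mat
  mat a b c d ⊙ mat a′ b′ c′ d′ = mat (a * a′ + b * c′) (a * b′ + b * d′) (c * a′ + d * c′) (c * b′ + d * d′)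

  apply-⊙ : ∀ X Y v → apply (X ⊙ Y) v ≋ apply X (apply Y v)
  apply-⊙ (mat a b c d) (mat a′ b′ c′ d′) (x , y) = row a b , row c d
    where
    row : ∀ a b → (a * a′ + b * c′) * x + (a * b′ + b * d′) * y ≈ a * (a′ * x + b′ * y) + b * (c′ * x + d′ * y)
    row a b = solve 8 (λ a b a′ b′ c′ d′ x y →
      (a :* a′ :+ b :* c′) :* x :+ (a :* b′ :+ b :* d′) :* y := a :* (a′ :* x :+ b′ :* y) :+ b :* (c′ :* x :+ d′ :* y))
      refl a b a′ b′ c′ d′ x y

  det-⊙ : ∀ X Y → det (X ⊙ Y) ≈ det X * det Y
  det-⊙ (mat a b c d) (mat a′ b′ c′ d′) = solve 8 (λ a b c d a′ b′ c′ d′ →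
    (a :* a′ :+ b :* c′) :* (c :* b′ :+ d :* d′) :+ :- ((a :* b′ :+ b :* d′) :* (c :* a′ :+ d :* c′))
    := (a :* d :+ :- (b :* c)) :* (a′ :* d′ :+ :- (b′ :* c′))) refl a b c d a′ b′ c′ d′

  infixl 7 _⊛ₘ_
  _⊛ₘ_ : Carrier → Mat → Mat
  s ⊛ₘ mat a b c d = mat (s * a) (s * b) (s * c) (s * d)

  apply-⊛ₘ : ∀ s M v → apply (s ⊛ₘ M) v ≋ s ⊛ apply M v
  apply-⊛ₘ s (mat a b c d) (x , y) =
    solve 5 (λ s a b x y → s :* a :* x :+ s :* b :* y := s :* (a :* x :+ b :* y)) refl s a b x y ,
    solve 5 (λ s a b x y → s :* a :* x :+ s :* b :* y := s :* (a :* x :+ b :* y)) refl s c d x y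

  det-⊛ₘ : ∀ s M → det (s ⊛ₘ M) ≈ (s * s) * det M
  det-⊛ₘ s (mat a b c d) = solve 5 (λ s a b c d →
    s :* a :* (s :* d) :+ :- (s :* b :* (s :* c)) := (s :* s) :* (a :* d :+ :- (b :* c))) refl s a b c d

  ∼-apply⁻¹ : ∀ M {u v} → det M ≉ 0# → apply M u ∼ apply M v → u ∼ v
  ∼-apply⁻¹ M {u} {v} detM≉0 Mu∼Mv =
    det₂≈0⇒∼ (x*y≈0⇒y≈0 detM≉0 (trans (sym (apply-det₂ M u v)) (∼⇒det₂≈0 Mu∼Mv)))

  module Transport (M : Mat) (detM≉0 : det M ≉ 0#) {S T : PointSet}
                   (onto : ∀ {v} → NonZeroV v → S v → ∃ λ w → NonZeroV w × T w × apply M w ∼ v) where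

    Card0-transport : Card0 T → Card0 S
    Card0-transport T-empty v v≢0 Sv = let (w , w≢0 , Tw , _) = onto v≢0 Sv in T-empty w w≢0 Tw

    Card2-transport : (∀ {w} → NonZeroV w → T w → S (apply M w)) → Card2 T → Card2 S
    Card2-transport into (u , w , u≢0 , w≢0 , Tu , Tw , u≁w , only-u-w) =
      apply M u , apply M w , apply-nonzero M detM≉0 u≢0 , apply-nonzero M detM≉0 w≢0 ,
      into u≢0 Tu , into w≢0 Tw , u≁w ∘ ∼-apply⁻¹ M detM≉0 , only
      where
      only : ∀ v → NonZeroV v → S v → v ∼ apply M u ⊎ v ∼ apply M w
      only v v≢0 Sv = classify (onto v≢0 Sv)
        where
        classify : (∃ λ x → NonZeroV x × T x × apply M x ∼ v) → v ∼ apply M u ⊎ v ∼ apply M w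
        classify (x , x≢0 , Tx , Mx∼v) = ⊎.map via via (only-u-w x x≢0 Tx)
          where
          via : ∀ {y} → x ∼ y → v ∼ apply M y
          via x∼y = ∼-trans (apply-nonzero M detM≉0 x≢0) (∼-sym Mx∼v) (∼-apply M x∼y)

  -- The conjugation is x ↦ pow x q, so that InSubfield, and with it PG1q and IsSubline, refer to
  -- its fixed field.
  module Conjugation (conjugation : IsInvolutiveAutomorphism R (λ x → pow x q)) where
    open IsInvolutiveAutomorphism conjugation
      renaming (cong to σ-cong; +-homo to σ-+; *-homo to σ-*; 1#-homo to σ-1; involutive to σ-σ)
    open import Algebra.Properties.Group +-group using (identityʳ-unique; inverseʳ-unique)

    σ : Carrier → Carrier
    σ x = pow x q

    σ-0 : σ 0# ≈ 0#
    σ-0 = identityʳ-unique (σ 0#) (σ 0#) (sym (trans (σ-cong (sym (+-identityʳ 0#))) (σ-+ 0# 0#)))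

    σ-‿homo : ∀ x → σ (- x) ≈ - σ x
    σ-‿homo x = inverseʳ-unique (σ x) (σ (- x)) (trans (sym (σ-+ x (- x))) (trans (σ-cong (-‿inverseʳ x)) σ-0))

    σ-sub : ∀ x y → σ (x - y) ≈ σ x - σ y
    σ-sub x y = trans (σ-+ x (- y)) (+-congˡ (σ-‿homo y))

    σ-≉0 : ∀ {x} → x ≉ 0# → σ x ≉ 0#
    σ-≉0 {x} x≉0 σx≈0 = x≉0 (trans (sym (σ-σ x)) (trans (σ-cong σx≈0) σ-0))

    σ-⁻¹ : ∀ {x} → x ≉ 0# → σ (x ⁻¹) ≈ σ x ⁻¹
    σ-⁻¹ {x} x≉0 = ⁻¹-unique (trans (sym (σ-* x (x ⁻¹))) (trans (σ-cong (x*x⁻¹≈1 x≉0)) σ-1))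

    InSubfield-cong : ∀ {x y} → x ≈ y → InSubfield x → InSubfield y
    InSubfield-cong x≈y σx≈x = trans (σ-cong (sym x≈y)) (trans σx≈x x≈y)

    InSubfield-0 : InSubfield 0#
    InSubfield-0 = σ-0

    InSubfield-1 : InSubfield 1#
    InSubfield-1 = σ-1

    InSubfield-+ : ∀ {x y} → InSubfield x → InSubfield y → InSubfield (x + y)
    InSubfield-+ {x} {y} σx≈x σy≈y = trans (σ-+ x y) (+-cong σx≈x σy≈y)

    InSubfield-* : ∀ {x y} → InSubfield x → InSubfield y → InSubfield (x * y)
    InSubfield-* {x} {y} σx≈x σy≈y = trans (σ-* x y) (*-cong σx≈x σy≈y)

    InSubfield-sub : ∀ {x y} → InSubfield x → InSubfield y → InSubfield (x - y)
    InSubfield-sub {x} {y} σx≈x σy≈y = trans (σ-sub x y) (+-cong σx≈x (-‿cong σy≈y))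

    InSubfield-⁻¹ : ∀ {x} → x ≉ 0# → InSubfield x → InSubfield (x ⁻¹)
    InSubfield-⁻¹ x≉0 σx≈x = trans (σ-⁻¹ x≉0) (⁻¹-cong (σ-≉0 x≉0) σx≈x)

    σv : V2 → V2
    σv (a , b) = (σ a , σ b)

    IsRational : V2 → Set
    IsRational (a , b) = InSubfield a × InSubfield b

    σv-cong : ∀ {u v} → u ≋ v → σv u ≋ σv v
    σv-cong (a≈ , b≈) = σ-cong a≈ , σ-cong b≈

    σv-involutive : ∀ u → σv (σv u) ≋ u
    σv-involutive (a , b) = σ-σ a , σ-σ b

    σv-⊛ : ∀ c u → σv (c ⊛ u) ≋ σ c ⊛ σv u
    σv-⊛ c (a , b) = σ-* c a , σ-* c b

    σv-⊕ : ∀ u v → σv (u ⊕ v) ≋ σv u ⊕ σv v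
    σv-⊕ (a , b) (c , d) = σ-+ a c , σ-+ b d

    σv-⊛-rational : ∀ {c} u → InSubfield c → σv (c ⊛ u) ≋ c ⊛ σv u
    σv-⊛-rational {c} (a , b) σc≈c = trans (σ-* c a) (*-congʳ σc≈c) , trans (σ-* c b) (*-congʳ σc≈c)

    σ-det₂ : ∀ u v → σ (det₂ u v) ≈ det₂ (σv u) (σv v)
    σ-det₂ (a , b) (c , d) = trans (σ-sub _ _) (+-cong (σ-* a d) (-‿cong (σ-* b c)))

    σ-det₂-σv : ∀ u v → σ (det₂ u (σv v)) ≈ - det₂ v (σv u)
    σ-det₂-σv u v = trans (σ-det₂ u (σv v)) (trans (det₂-cong V.refl (σv-involutive v)) (det₂-antisym (σv u) v))

    ∼-σv : ∀ {u v} → u ∼ v → σv u ∼ σv v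
    ∼-σv {a , b} {c , d} ad≈bc = trans (sym (σ-* a d)) (trans (σ-cong ad≈bc) (σ-* b c))

    rational-det₂ : ∀ {u v} → IsRational u → IsRational v → InSubfield (det₂ u v)
    rational-det₂ (ra , rb) (rc , rd) = InSubfield-sub (InSubfield-* ra rd) (InSubfield-* rb rc)

    rational-⊛⊕ : ∀ {s u v} → InSubfield s → IsRational u → IsRational v → IsRational (s ⊛ u ⊕ v)
    rational-⊛⊕ rs (ra , rb) (rc , rd) = InSubfield-+ (InSubfield-* rs ra) rc , InSubfield-+ (InSubfield-* rs rb) rd

    SelfConjugate : V2 → Set
    SelfConjugate z = z ∼ σv z

    ∼-rational⇒selfConjugate : ∀ {z u} → IsRational u → NonZeroV u → z ∼ u → SelfConjugate z
    ∼-rational⇒selfConjugate {z} {u} u-rational u≢0 z∼u =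
      ∼-trans u≢0 z∼u (∼-sym (∼-resp-≋ V.refl u-rational (∼-σv z∼u)))

    selfConjugate⇒⊛-rational : ∀ {z} → NonZeroV z → SelfConjugate z →
                                ∃₂ λ c u → c ≉ 0# × IsRational u × z ≋ c ⊛ u
    selfConjugate⇒⊛-rational {a , b} z≢0 aσb≈bσa with b ≟ 0#
    ... | yes b≈0 = a , (1# , 0#) , (λ a≈0 → z≢0 (a≈0 , b≈0)) , (InSubfield-1 , InSubfield-0) ,
                    sym (*-identityʳ a) , trans b≈0 (sym (zeroʳ a))
    ... | no b≉0 = b , (a * b ⁻¹ , 1#) , b≉0 , (rational , InSubfield-1) ,
                   sym (trans (solve 3 (λ a b b′ → b :* (a :* b′) := a :* (b :* b′)) refl a b (b ⁻¹))
                              (trans (*-congˡ (x*x⁻¹≈1 b≉0)) (*-identityʳ a))) ,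
                   sym (*-identityʳ b)
      where
      rational : InSubfield (a * b ⁻¹)
      rational = begin
        σ (a * b ⁻¹)      ≈⟨ σ-* a (b ⁻¹) ⟩
        σ a * σ (b ⁻¹)    ≈⟨ *-congˡ (σ-⁻¹ b≉0) ⟩
        σ a * σ b ⁻¹      ≈⟨ cross-multiplication (σ-≉0 b≉0) b≉0 (trans (*-comm _ _) (sym aσb≈bσa)) ⟩
        a * b ⁻¹          ∎

    selfConjugate⇒∼-rational : ∀ {z} → NonZeroV z → SelfConjugate z →
                                ∃ λ u → IsRational u × NonZeroV u × u ∼ z
    selfConjugate⇒∼-rational z≢0 z-selfConjugate with selfConjugate⇒⊛-rational z≢0 z-selfConjugate
    ... | c , u , c≉0 , u-rational , z≋cu =
      u , u-rational , u≢0 , ∼-sym (∼-resp-≋ (V.sym z≋cu) V.refl (⊛-∼ c u))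
      where
      u≢0 : NonZeroV u
      u≢0 (x≈0 , y≈0) = z≢0 (V.trans z≋cu (trans (*-congˡ x≈0) (zeroʳ c) , trans (*-congˡ y≈0) (zeroʳ c)))

    rational-complement : ∀ {w} → NonZeroV w → ∃ λ w′ → IsRational w′ × det₂ w w′ ≉ 0#
    rational-complement {a , b} w≢0 with b ≟ 0#
    ... | yes b≈0 = (0# , 1#) , (InSubfield-0 , InSubfield-1) , λ det≈0 →
      w≢0 (trans (solve 2 (λ a b → a := a :* con (+ 1) :- b :* con (+ 0)) refl a b) det≈0 , b≈0)
    ... | no b≉0 = (1# , 0#) , (InSubfield-1 , InSubfield-0) , λ det≈0 →
      b≉0 (trans (solve 2 (λ a b → b := :- (a :* con (+ 0) :- b :* con (+ 1))) refl a b)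
                 (trans (-‿cong det≈0) -0#≈0#))

    module Subline {Ω : PointSet} (sub : IsSubline Ω) where
      private
        M = proj₁ sub
        det≉0 = proj₁ (proj₂ sub)
        Ω≡ = proj₂ (proj₂ sub)

      ∈⇒rational : ∀ {v} → NonZeroV v → Ω v → ∃ λ w → IsRational w × NonZeroV w × apply M w ∼ v
      ∈⇒rational {v} v≢0 v∈Ω with proj₁ (Ω≡ v v≢0) v∈Ω
      ... | u , u≢0 , (x , y , x∈K , y∈K , xy≢0 , xy∼u) , Mu∼v =
        (x , y) , (x∈K , y∈K) , xy≢0 , ∼-trans (apply-nonzero M det≉0 u≢0) (∼-apply M xy∼u) Mu∼v

      rational⇒∈ : ∀ {w v} → IsRational w → NonZeroV w → NonZeroV v → apply M w ∼ v → Ω v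
      rational⇒∈ {w} {v} (x∈K , y∈K) w≢0 v≢0 Mw∼v =
        proj₂ (Ω≡ v v≢0) (w , w≢0 , (proj₁ w , proj₂ w , x∈K , y∈K , w≢0 , ∼-refl) , Mw∼v)

    RationalTimesSquare : Carrier → Set
    RationalTimesSquare x = ∃₂ λ k m → InSubfield k × k ≉ 0# × m ≉ 0# × x ≈ k * (m * m)

    RationalTimesSquare-resp : ∀ {x y} → x ≈ y → RationalTimesSquare x → RationalTimesSquare y
    RationalTimesSquare-resp x≈y (k , m , k∈K , k≉0 , m≉0 , x≈kmm) = k , m , k∈K , k≉0 , m≉0 , trans (sym x≈y) x≈kmm

    Shared : Mat → V2 → Set
    Shared N w = IsRational w × SelfConjugate (apply N w)

    module Pencil (N : Mat) {w₁ w₂ : V2} (w₁-rational : IsRational w₁) (w₂-rational : IsRational w₂) where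
      n₁ n₂ : V2
      n₁ = apply N w₁
      n₂ = apply N w₂

      Δ α β γ : Carrier
      Δ = det₂ w₁ w₂
      α = det₂ n₁ (σv n₂) + det₂ n₂ (σv n₁)
      β = det₂ n₂ (σv n₂)
      γ = det₂ n₁ (σv n₁)

      Q : V2 → Carrier
      Q w = det₂ (apply N w) (σv (apply N w))

      Q-expansion : ∀ {w} → IsRational w → let s = det₂ w w₂; t = det₂ w₁ w in
                    (Δ * Δ) * Q w ≈ (s * s) * γ + (s * t) * α + (t * t) * β
      Q-expansion {w} w-rational = begin
        (Δ * Δ) * Q w                              ≈⟨ det₂-⊛ Δ (apply N w) (σv (apply N w)) ⟨
        det₂ (Δ ⊛ apply N w) (Δ ⊛ σv (apply N w))   ≈⟨ det₂-cong Δz≋ Δσz≋ ⟩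
        det₂ (s ⊛ n₁ ⊕ t ⊛ n₂) (s ⊛ σv n₁ ⊕ t ⊛ σv n₂) ≈⟨ det₂-bilinear s t n₁ (σv n₁) n₂ (σv n₂) ⟩
        (s * s) * γ + (s * t) * α + (t * t) * β    ∎
        where
        s = det₂ w w₂
        t = det₂ w₁ w
        Δz≋ : Δ ⊛ apply N w ≋ s ⊛ n₁ ⊕ t ⊛ n₂
        Δz≋ = V.trans (V.sym (apply-⊛ N Δ w)) (V.trans (apply-cong N (det₂-decomposition w₁ w₂ w))
                (V.trans (apply-⊕ N (s ⊛ w₁) (t ⊛ w₂)) (⊕-cong (apply-⊛ N s w₁) (apply-⊛ N t w₂))))
        Δσz≋ : Δ ⊛ σv (apply N w) ≋ s ⊛ σv n₁ ⊕ t ⊛ σv n₂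
        Δσz≋ = V.trans (V.sym (σv-⊛-rational (apply N w) (rational-det₂ w₁-rational w₂-rational)))
                 (V.trans (σv-cong Δz≋) (V.trans (σv-⊕ (s ⊛ n₁) (t ⊛ n₂))
                   (⊕-cong (σv-⊛-rational n₁ (rational-det₂ w-rational w₂-rational))
                           (σv-⊛-rational n₂ (rational-det₂ w₁-rational w-rational)))))

      σα≈-α : σ α ≈ - α
      σα≈-α = begin
        σ α                                     ≈⟨ σ-+ _ _ ⟩
        σ (det₂ n₁ (σv n₂)) + σ (det₂ n₂ (σv n₁)) ≈⟨ +-cong (σ-det₂-σv n₁ n₂) (σ-det₂-σv n₂ n₁) ⟩
        - det₂ n₂ (σv n₁) - det₂ n₁ (σv n₂)     ≈⟨ ⁻¹-∙-comm _ _ ⟩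
        - (det₂ n₂ (σv n₁) + det₂ n₁ (σv n₂))   ≈⟨ -‿cong (+-comm _ _) ⟩
        - α                                     ∎
        where open import Algebra.Properties.AbelianGroup +-abelianGroup using (⁻¹-∙-comm)

      σβ≈-β : σ β ≈ - β
      σβ≈-β = σ-det₂-σv n₂ n₂

      module _ (γ≈0 : γ ≈ 0#) where
        Q-factorisation : ∀ {w} → IsRational w →
                          (Δ * Δ) * Q w ≈ det₂ w₁ w * (det₂ w w₂ * α + det₂ w₁ w * β)
        Q-factorisation {w} w-rational = begin
          (Δ * Δ) * Q w
            ≈⟨ Q-expansion w-rational ⟩
          (s * s) * γ + (s * t) * α + (t * t) * β
            ≈⟨ +-congʳ (+-congʳ (trans (*-congˡ γ≈0) (zeroʳ _))) ⟩
          0# + (s * t) * α + (t * t) * β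
            ≈⟨ solve 4 (λ s t a b → con (+ 0) :+ (s :* t) :* a :+ (t :* t) :* b := t :* (s :* a :+ t :* b)) refl s t α β ⟩
          t * (s * α + t * β) ∎
          where
          s = det₂ w w₂
          t = det₂ w₁ w

        module NonDegenerate (Δ≉0 : Δ ≉ 0#) (α≉0 : α ≉ 0#) where
          s₀ : Carrier
          s₀ = - β * α ⁻¹

          s₀α≈-β : s₀ * α ≈ - β
          s₀α≈-β = trans (*-assoc _ _ _) (trans (*-congˡ (x⁻¹*x≈1 α≉0)) (*-identityʳ _))

          s₀α+β≈0 : s₀ * α + β ≈ 0#
          s₀α+β≈0 = trans (+-congʳ s₀α≈-β) (-‿inverseˡ β)

          s₀-rational : InSubfield s₀
          s₀-rational = *-cancelʳ α≉0 (begin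
            σ s₀ * α          ≈⟨ *-congˡ (trans (-‿cong σα≈-α) (-‿involutive α)) ⟨
            σ s₀ * - σ α      ≈⟨ -‿distribʳ-* _ _ ⟨
            - (σ s₀ * σ α)    ≈⟨ -‿cong (trans (sym (σ-* s₀ α)) (σ-cong s₀α≈-β)) ⟩
            - σ (- β)         ≈⟨ -‿cong (trans (σ-‿homo β) (-‿cong σβ≈-β)) ⟩
            - - - β           ≈⟨ -‿involutive _ ⟩
            - β               ≈⟨ s₀α≈-β ⟨
            s₀ * α            ∎)

          w₃ : V2
          w₃ = s₀ ⊛ w₁ ⊕ w₂

          det₂w₁w₃≈Δ : det₂ w₁ w₃ ≈ Δ
          det₂w₁w₃≈Δ = det₂-shearˡ s₀ w₁ w₂

          det₂w₁w₃≉0 : det₂ w₁ w₃ ≉ 0#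
          det₂w₁w₃≉0 = Δ≉0 ∘ trans (sym det₂w₁w₃≈Δ)

          w₃-shared : Shared N w₃
          w₃-shared = w₃-rational , det₂≈0⇒∼ (x*y≈0⇒y≈0 (*-≉0 Δ≉0 Δ≉0) (begin
            (Δ * Δ) * Q w₃
              ≈⟨ Q-factorisation w₃-rational ⟩
            det₂ w₁ w₃ * (det₂ w₃ w₂ * α + det₂ w₁ w₃ * β)
              ≈⟨ *-cong det₂w₁w₃≈Δ (+-cong (*-congʳ (det₂-shearʳ s₀ w₁ w₂)) (*-congʳ det₂w₁w₃≈Δ)) ⟩
            Δ * ((s₀ * Δ) * α + Δ * β)
              ≈⟨ solve 4 (λ d s a b → d :* ((s :* d) :* a :+ d :* b) := (d :* d) :* (s :* a :+ b)) refl Δ s₀ α β ⟩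
            (Δ * Δ) * (s₀ * α + β)
              ≈⟨ *-congˡ s₀α+β≈0 ⟩
            (Δ * Δ) * 0#
              ≈⟨ zeroʳ _ ⟩
            0# ∎))
            where w₃-rational = rational-⊛⊕ s₀-rational w₁-rational w₂-rational

          shared⇒∼w₁⊎∼w₃ : ∀ {w} → Shared N w → w ∼ w₁ ⊎ w ∼ w₃
          shared⇒∼w₁⊎∼w₃ {w} (w-rational , w-selfConjugate) with det₂ w₁ w ≟ 0#
          ... | yes t≈0 = inj₁ (∼-sym (det₂≈0⇒∼ t≈0))
          ... | no t≉0 = inj₂ (det₂≈0⇒∼ (trans (det₂-shear s₀ w₁ w₂ w) (x*y≈0⇒y≈0 α≉0 (begin
            α * (s - t * s₀)
              ≈⟨ solve 5 (λ a s t s₀ b → a :* (s :- t :* s₀) := (s :* a :+ t :* b) :- t :* (s₀ :* a :+ b)) refl α s t s₀ β ⟩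
            (s * α + t * β) - t * (s₀ * α + β)
              ≈⟨ +-cong sα+tβ≈0 (-‿cong (trans (*-congˡ s₀α+β≈0) (zeroʳ t))) ⟩
            0# - 0#
              ≈⟨ -‿inverseʳ 0# ⟩
            0# ∎))))
            where
            s = det₂ w w₂
            t = det₂ w₁ w
            sα+tβ≈0 : s * α + t * β ≈ 0#
            sα+tβ≈0 = x*y≈0⇒y≈0 t≉0 (trans (sym (Q-factorisation w-rational))
                        (trans (*-congˡ (∼⇒det₂≈0 w-selfConjugate)) (zeroʳ _)))

          two-shared : NonZeroV w₁ → Card2 (Shared N)
          two-shared w₁≢0 = w₁ , w₃ , w₁≢0 , det₂≉0⇒nonzeroʳ det₂w₁w₃≉0 , (w₁-rational , det₂≈0⇒∼ γ≈0) ,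
                            w₃-shared , det₂w₁w₃≉0 ∘ ∼⇒det₂≈0 , λ w _ → shared⇒∼w₁⊎∼w₃

        module Degenerate (α≈0 : α ≈ 0#) {c u} (c≉0 : c ≉ 0#) (u-rational : IsRational u) (n₁≋cu : n₁ ≋ c ⊛ u) where
          τ : Carrier
          τ = det₂ u n₂

          στ≈ : σ τ ≈ det₂ u (σv n₂)
          στ≈ = trans (σ-det₂ u n₂) (det₂-cong u-rational V.refl)

          σn₁≋ : σv n₁ ≋ σ c ⊛ u
          σn₁≋ = V.trans (σv-cong n₁≋cu) (V.trans (σv-⊛ c u) (⊛-cong (σ c) u-rational))

          α≈cστ-σcτ : α ≈ c * σ τ - σ c * τ
          α≈cστ-σcτ = begin
            det₂ n₁ (σv n₂) + det₂ n₂ (σv n₁)          ≈⟨ +-cong (det₂-cong n₁≋cu V.refl) (det₂-cong V.refl σn₁≋) ⟩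
            det₂ (c ⊛ u) (σv n₂) + det₂ n₂ (σ c ⊛ u)   ≈⟨ +-cong (det₂-⊛ˡ c u (σv n₂)) (det₂-antisym n₂ (σ c ⊛ u)) ⟩
            c * det₂ u (σv n₂) - det₂ (σ c ⊛ u) n₂     ≈⟨ +-cong (*-congˡ (sym στ≈)) (-‿cong (det₂-⊛ˡ (σ c) u n₂)) ⟩
            c * σ τ - σ c * τ                          ∎

          τc⁻¹-rational : InSubfield (τ * c ⁻¹)
          τc⁻¹-rational = begin
            σ (τ * c ⁻¹)       ≈⟨ trans (σ-* τ (c ⁻¹)) (*-congˡ (σ-⁻¹ c≉0)) ⟩
            σ τ * σ c ⁻¹       ≈⟨ cross-multiplication (σ-≉0 c≉0) c≉0 στc≈τσc ⟩
            τ * c ⁻¹           ∎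
            where
            στc≈τσc : σ τ * c ≈ τ * σ c
            στc≈τσc = trans (*-comm _ _) (trans (x∙y⁻¹≈ε⇒x≈y _ _ (trans (sym α≈cστ-σcτ) α≈0)) (*-comm _ _))

          detN*Δ≈cτ : det N * Δ ≈ c * τ
          detN*Δ≈cτ = trans (sym (apply-det₂ N w₁ w₂)) (trans (det₂-cong n₁≋cu V.refl) (det₂-⊛ˡ c u n₂))

          rationalTimesSquare : det N ≉ 0# → Δ ≉ 0# → RationalTimesSquare (det N)
          rationalTimesSquare detN≉0 Δ≉0 =
            τ * c ⁻¹ * Δ ⁻¹ , c , InSubfield-* τc⁻¹-rational (InSubfield-⁻¹ Δ≉0 (rational-det₂ w₁-rational w₂-rational)) ,
            *-≉0 (*-≉0 τ≉0 (⁻¹-≉0 c≉0)) (⁻¹-≉0 Δ≉0) , c≉0 , (begin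
              det N
                ≈⟨ *-identityʳ _ ⟨
              det N * 1#
                ≈⟨ *-congˡ (x*x⁻¹≈1 Δ≉0) ⟨
              det N * (Δ * Δ ⁻¹)
                ≈⟨ *-assoc _ _ _ ⟨
              det N * Δ * Δ ⁻¹
                ≈⟨ *-congʳ detN*Δ≈cτ ⟩
              c * τ * Δ ⁻¹
                ≈⟨ *-identityʳ _ ⟨
              c * τ * Δ ⁻¹ * 1#
                ≈⟨ *-congˡ (x⁻¹*x≈1 c≉0) ⟨
              c * τ * Δ ⁻¹ * (c ⁻¹ * c)
                ≈⟨ solve 4 (λ c t d c′ → c :* t :* d :* (c′ :* c) := t :* c′ :* d :* (c :* c)) refl c τ (Δ ⁻¹) (c ⁻¹) ⟩
              τ * c ⁻¹ * Δ ⁻¹ * (c * c) ∎)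
            where
            τ≉0 : τ ≉ 0#
            τ≉0 τ≈0 = *-≉0 detN≉0 Δ≉0 (trans detN*Δ≈cτ (trans (*-congˡ τ≈0) (zeroʳ c)))

    shared-point-dichotomy : ∀ N → det N ≉ 0# → ∀ {w₁} → NonZeroV w₁ → Shared N w₁ →
                             RationalTimesSquare (det N) ⊎ Card2 (Shared N)
    shared-point-dichotomy N detN≉0 {w₁} w₁≢0 (w₁-rational , w₁-selfConjugate) =
      by-complement (rational-complement w₁≢0)
      where
      by-complement : (∃ λ w₂ → IsRational w₂ × det₂ w₁ w₂ ≉ 0#) → RationalTimesSquare (det N) ⊎ Card2 (Shared N)
      by-complement (w₂ , w₂-rational , Δ≉0) = by-α (α ≟ 0#)
        where
        open Pencil N w₁-rational w₂-rational
        γ≈0 = ∼⇒det₂≈0 w₁-selfConjugate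
        scaled-n₁ = selfConjugate⇒⊛-rational (apply-nonzero N detN≉0 w₁≢0) w₁-selfConjugate
        by-α : Dec (α ≈ 0#) → RationalTimesSquare (det N) ⊎ Card2 (Shared N)
        by-α (no α≉0) = inj₂ (NonDegenerate.two-shared γ≈0 Δ≉0 α≉0 w₁≢0)
        by-α (yes α≈0) = let (c , u , c≉0 , u-rational , n₁≋cu) = scaled-n₁
                         in inj₁ (Degenerate.rationalTimesSquare γ≈0 α≈0 c≉0 u-rational n₁≋cu detN≉0 Δ≉0)

    module Rescaling {Ω₁ Ω₂ : PointSet} (sub₁ : IsSubline Ω₁) (sub₂ : IsSubline Ω₂) {k m : Carrier}
                     (k-rational : InSubfield k) (k≉0 : k ≉ 0#) (m≉0 : m ≉ 0#)
                     (d₂d₁≈kmm : det (proj₁ sub₂) * det (proj₁ sub₁) ≈ k * (m * m)) where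
      module S₁ = Subline sub₁
      module S₂ = Subline sub₂
      M₁ = proj₁ sub₁
      M₂ = proj₁ sub₂
      det₁≉0 = proj₁ (proj₂ sub₁)
      det₂≉0 = proj₁ (proj₂ sub₂)

      D : Mat
      D = mat (k ⁻¹) 0# 0# 1#

      -- D maps PG(1,q) onto itself and has determinant k⁻¹, which cancels the factor k of det M₂ * det M₁.
      g : Mat
      g = m ⁻¹ ⊛ₘ (M₂ ⊙ D ⊙ adj M₁)

      detD≈k⁻¹ : det D ≈ k ⁻¹
      detD≈k⁻¹ = solve 1 (λ k′ → k′ :* con (+ 1) :+ :- (con (+ 0) :* con (+ 0)) := k′) refl (k ⁻¹)

      detg≈1 : det g ≈ 1#
      detg≈1 = begin
        det g
          ≈⟨ det-⊛ₘ (m ⁻¹) _ ⟩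
        (m ⁻¹ * m ⁻¹) * det (M₂ ⊙ D ⊙ adj M₁)               ≈⟨ *-congˡ (trans (det-⊙ (M₂ ⊙ D) (adj M₁))
                                                                   (*-cong (trans (det-⊙ M₂ D) (*-congˡ detD≈k⁻¹)) (det-adj M₁))) ⟩
        (m ⁻¹ * m ⁻¹) * (det M₂ * k ⁻¹ * det M₁)
          ≈⟨ solve 4 (λ m′ d₂ k′ d₁ → (m′ :* m′) :* (d₂ :* k′ :* d₁) := (k′ :* (m′ :* m′)) :* (d₂ :* d₁))
                     refl (m ⁻¹) (det M₂) (k ⁻¹) (det M₁) ⟩
        (k ⁻¹ * (m ⁻¹ * m ⁻¹)) * (det M₂ * det M₁)
          ≈⟨ *-congˡ d₂d₁≈kmm ⟩
        (k ⁻¹ * (m ⁻¹ * m ⁻¹)) * (k * (m * m))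
          ≈⟨ solve 4 (λ k′ m′ k m → (k′ :* (m′ :* m′)) :* (k :* (m :* m)) := (k′ :* k) :* ((m′ :* m) :* (m′ :* m)))
                     refl (k ⁻¹) (m ⁻¹) k m ⟩
        (k ⁻¹ * k) * ((m ⁻¹ * m) * (m ⁻¹ * m))
          ≈⟨ *-cong (x⁻¹*x≈1 k≉0) (*-cong (x⁻¹*x≈1 m≉0) (x⁻¹*x≈1 m≉0)) ⟩
        1# * (1# * 1#)
          ≈⟨ trans (*-identityˡ _) (*-identityˡ _) ⟩
        1# ∎

      detg≉0 : det g ≉ 0#
      detg≉0 detg≈0 = nontrivial (trans (sym detg≈1) detg≈0)

      gM₁∼M₂D : ∀ w → apply g (apply M₁ w) ∼ apply M₂ (apply D w)
      gM₁∼M₂D w = ∼-resp-≋ (V.sym gM₁w≋) V.refl (⊛-∼ (m ⁻¹ * det M₁) (apply M₂ (apply D w)))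
        where
        gM₁w≋ : apply g (apply M₁ w) ≋ (m ⁻¹ * det M₁) ⊛ apply M₂ (apply D w)
        gM₁w≋ = V.trans (apply-⊛ₘ (m ⁻¹) _ (apply M₁ w)) (V.trans (⊛-cong (m ⁻¹)
                  (V.trans (apply-⊙ (M₂ ⊙ D) (adj M₁) (apply M₁ w)) (V.trans (apply-⊙ M₂ D _)
                    (apply-cong M₂ (V.trans (apply-cong D (apply-adj-apply M₁ w)) (apply-⊛ D (det M₁) w))))))
                  (V.trans (⊛-cong (m ⁻¹) (apply-⊛ M₂ (det M₁) (apply D w))) (⊛-assoc (m ⁻¹) (det M₁) _)))

      D-rational : ∀ {w} → IsRational w → IsRational (apply D w)
      D-rational (x∈K , y∈K) = InSubfield-+ (InSubfield-* (InSubfield-⁻¹ k≉0 k-rational) x∈K) (InSubfield-* InSubfield-0 y∈K)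
                             , InSubfield-+ (InSubfield-* InSubfield-0 x∈K) (InSubfield-* InSubfield-1 y∈K)

      detD≉0 : det D ≉ 0#
      detD≉0 detD≈0 = ⁻¹-≉0 k≉0 (trans (sym detD≈k⁻¹) detD≈0)

      forward : ∀ {v} → NonZeroV v → Image g Ω₁ v → Ω₂ v
      forward v≢0 (w′ , w′≢0 , w′∈Ω₁ , gw′∼v) = conclude (S₁.∈⇒rational w′≢0 w′∈Ω₁)
        where
        conclude : (∃ λ w → IsRational w × NonZeroV w × apply M₁ w ∼ w′) → Ω₂ _
        conclude (w , w-rational , w≢0 , M₁w∼w′) =
          S₂.rational⇒∈ (D-rational w-rational) (apply-nonzero D detD≉0 w≢0) v≢0
            (∼-trans (apply-nonzero g detg≉0 (apply-nonzero M₁ det₁≉0 w≢0)) (∼-sym (gM₁∼M₂D w))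
              (∼-trans (apply-nonzero g detg≉0 w′≢0) (∼-apply g M₁w∼w′) gw′∼v))

      backward : ∀ {v} → NonZeroV v → Ω₂ v → Image g Ω₁ v
      backward v≢0 v∈Ω₂ = conclude (S₂.∈⇒rational v≢0 v∈Ω₂)
        where
        conclude : (∃ λ u → IsRational u × NonZeroV u × apply M₂ u ∼ _) → Image g Ω₁ _
        conclude ((x , y) , (x∈K , y∈K) , u≢0 , M₂u∼v) =
          apply M₁ w , apply-nonzero M₁ det₁≉0 w≢0 , S₁.rational⇒∈ w-rational w≢0 (apply-nonzero M₁ det₁≉0 w≢0) ∼-refl ,
          ∼-trans (apply-nonzero M₂ det₂≉0 u≢0) (∼-resp-≋ V.refl (apply-cong M₂ Dw≋u) (gM₁∼M₂D w)) M₂u∼v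
          where
          w = (k * x , y)
          w-rational : IsRational w
          w-rational = InSubfield-* k-rational x∈K , y∈K
          w≢0 : NonZeroV w
          w≢0 (kx≈0 , y≈0) = u≢0 (x*y≈0⇒y≈0 k≉0 kx≈0 , y≈0)
          Dw≋u : apply D w ≋ (x , y)
          Dw≋u = trans (solve 4 (λ k′ k x y → k′ :* (k :* x) :+ con (+ 0) :* y := (k′ :* k) :* x) refl (k ⁻¹) k x y)
                       (trans (*-congʳ (x⁻¹*x≈1 k≉0)) (*-identityˡ x)) ,
                 solve 3 (λ k x y → con (+ 0) :* (k :* x) :+ con (+ 1) :* y := y) refl k x y

    same-orbit : ∀ {Ω₁ Ω₂} (sub₁ : IsSubline Ω₁) (sub₂ : IsSubline Ω₂) →
                 RationalTimesSquare (det (proj₁ sub₂) * det (proj₁ sub₁)) →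
                 ∃ λ g → InSL g × SameSet (Image g Ω₁) Ω₂
    same-orbit sub₁ sub₂ (k , m , k-rational , k≉0 , m≉0 , d₂d₁≈kmm) =
      g , detg≈1 , λ v v≢0 → forward v≢0 , backward v≢0
      where open Rescaling sub₁ sub₂ k-rational k≉0 m≉0 d₂d₁≈kmm

    module Intersection {Ω₁ Ω₂ : PointSet} (sub₁ : IsSubline Ω₁) (sub₂ : IsSubline Ω₂) (g : Mat) (detg≈1 : InSL g) where
      module S₁ = Subline sub₁
      module S₂ = Subline sub₂
      M₁ = proj₁ sub₁
      M₂ = proj₁ sub₂
      det₁≉0 = proj₁ (proj₂ sub₁)
      det₂≉0 = proj₁ (proj₂ sub₂)

      B N : Mat
      B = g ⊙ M₁
      N = adj M₂ ⊙ B

      detg≉0 : det g ≉ 0#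
      detg≉0 detg≈0 = nontrivial (trans (sym detg≈1) detg≈0)

      detB≉0 : det B ≉ 0#
      detB≉0 detB≈0 = *-≉0 detg≉0 det₁≉0 (trans (sym (det-⊙ g M₁)) detB≈0)

      detadjM₂≉0 : det (adj M₂) ≉ 0#
      detadjM₂≉0 = det₂≉0 ∘ trans (sym (det-adj M₂))

      detN≈d₂d₁ : det N ≈ det M₂ * det M₁
      detN≈d₂d₁ = begin
        det (adj M₂ ⊙ (g ⊙ M₁))     ≈⟨ trans (det-⊙ (adj M₂) B) (*-cong (det-adj M₂) (det-⊙ g M₁)) ⟩
        det M₂ * (det g * det M₁)   ≈⟨ *-congˡ (trans (*-congʳ detg≈1) (*-identityˡ _)) ⟩
        det M₂ * det M₁             ∎

      detN≉0 : det N ≉ 0#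
      detN≉0 detN≈0 = *-≉0 det₂≉0 det₁≉0 (trans (sym detN≈d₂d₁) detN≈0)

      meet⇒shared : ∀ {v} → NonZeroV v → (Image g Ω₁ ∩ Ω₂) v → ∃ λ w → NonZeroV w × Shared N w × apply B w ∼ v
      meet⇒shared {v} v≢0 ((w′ , w′≢0 , w′∈Ω₁ , gw′∼v) , v∈Ω₂) =
        combine (S₁.∈⇒rational w′≢0 w′∈Ω₁) (S₂.∈⇒rational v≢0 v∈Ω₂)
        where
        combine : (∃ λ w → IsRational w × NonZeroV w × apply M₁ w ∼ w′) →
                  (∃ λ u → IsRational u × NonZeroV u × apply M₂ u ∼ v) →
                  ∃ λ w → NonZeroV w × Shared N w × apply B w ∼ v
        combine (w , w-rational , w≢0 , M₁w∼w′) (u , u-rational , u≢0 , M₂u∼v) =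
          w , w≢0 , (w-rational , ∼-rational⇒selfConjugate u-rational u≢0 Nw∼u) , Bw∼v
          where
          Bw∼v : apply B w ∼ v
          Bw∼v = ∼-resp-≋ (V.sym (apply-⊙ g M₁ w)) V.refl
                   (∼-trans (apply-nonzero g detg≉0 w′≢0) (∼-apply g M₁w∼w′) gw′∼v)
          adjM₂v∼u : apply (adj M₂) v ∼ u
          adjM₂v∼u = ∼-trans (apply-nonzero (adj M₂) detadjM₂≉0 (apply-nonzero M₂ det₂≉0 u≢0))
                       (∼-apply (adj M₂) (∼-sym M₂u∼v))
                       (∼-resp-≋ (V.sym (apply-adj-apply M₂ u)) V.refl (⊛-∼ (det M₂) u))
          Nw∼u : apply N w ∼ u
          Nw∼u = ∼-resp-≋ (V.sym (apply-⊙ (adj M₂) B w)) V.refl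
                   (∼-trans (apply-nonzero (adj M₂) detadjM₂≉0 v≢0) (∼-apply (adj M₂) Bw∼v) adjM₂v∼u)

      shared⇒meet : ∀ {w} → NonZeroV w → Shared N w → (Image g Ω₁ ∩ Ω₂) (apply B w)
      shared⇒meet {w} w≢0 (w-rational , Nw-selfConjugate) =
        (apply M₁ w , M₁w≢0 , S₁.rational⇒∈ w-rational w≢0 M₁w≢0 ∼-refl , ≋⇒∼ (V.sym (apply-⊙ g M₁ w))) ,
        in-Ω₂ (selfConjugate⇒∼-rational (apply-nonzero N detN≉0 w≢0) Nw-selfConjugate)
        where
        M₁w≢0 = apply-nonzero M₁ det₁≉0 w≢0
        in-Ω₂ : (∃ λ u → IsRational u × NonZeroV u × u ∼ apply N w) → Ω₂ (apply B w)
        in-Ω₂ (u , u-rational , u≢0 , u∼Nw) = S₂.rational⇒∈ u-rational u≢0 (apply-nonzero B detB≉0 w≢0)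
          (∼-trans (apply-nonzero M₂ det₂≉0 (apply-nonzero N detN≉0 w≢0)) (∼-apply M₂ u∼Nw)
            (∼-resp-≋ (V.sym (V.trans (apply-cong M₂ (apply-⊙ (adj M₂) B w)) (apply-apply-adj M₂ (apply B w)))) V.refl
              (⊛-∼ (det M₂) (apply B w))))

      open Transport B detB≉0 meet⇒shared public

      SharedPair : Carrier → Carrier → Set
      SharedPair x y = NonZeroV (x , y) × Shared N (x , y)

      SharedPair? : ∀ x y → Dec (SharedPair x y)
      SharedPair? x y = ¬? ((x ≟ 0#) ×-dec (y ≟ 0#)) ×-dec (((σ x ≟ x) ×-dec (σ y ≟ y)) ×-dec (_ ≟ _))

      SharedPair-resp : ∀ {x x′ y y′} → x ≈ x′ → y ≈ y′ → SharedPair x y → SharedPair x′ y′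
      SharedPair-resp x≈x′ y≈y′ (w≢0 , (x∈K , y∈K) , Nw-selfConjugate) =
        nonzero-resp-≋ (x≈x′ , y≈y′) w≢0 ,
        (InSubfield-cong x≈x′ x∈K , InSubfield-cong y≈y′ y∈K) ,
        ∼-resp-≋ Nw≋Nw′ (σv-cong Nw≋Nw′) Nw-selfConjugate
        where Nw≋Nw′ = apply-cong N (x≈x′ , y≈y′)

    subline-intersection : Searchable² setoid → (Ω₁ Ω₂ : PointSet) → IsSubline Ω₁ → IsSubline Ω₂ →
                           (∀ g → InSL g → ¬ SameSet (Image g Ω₁) Ω₂) →
                           ∀ g → InSL g → Card0 (Image g Ω₁ ∩ Ω₂) ⊎ Card2 (Image g Ω₁ ∩ Ω₂)
    subline-intersection search Ω₁ Ω₂ sub₁ sub₂ different-orbits g detg≈1 =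
      count (search SharedPair SharedPair? SharedPair-resp)
      where
      open Intersection sub₁ sub₂ g detg≈1

      ¬rationalTimesSquare : ¬ RationalTimesSquare (det N)
      ¬rationalTimesSquare rts = let (g′ , g′∈SL , same) = same-orbit sub₁ sub₂ (RationalTimesSquare-resp detN≈d₂d₁ rts)
                                 in different-orbits g′ g′∈SL same

      count : (∃₂ SharedPair) ⊎ (∀ x y → ¬ SharedPair x y) → Card0 (Image g Ω₁ ∩ Ω₂) ⊎ Card2 (Image g Ω₁ ∩ Ω₂)
      count (inj₂ none) = inj₁ (Card0-transport (λ w w≢0 w-shared → none (proj₁ w) (proj₂ w) (w≢0 , w-shared)))
      count (inj₁ (_ , _ , w≢0 , w-shared)) =
        inj₂ (Card2-transport shared⇒meet (two-shared (shared-point-dichotomy N detN≉0 w≢0 w-shared)))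
        where
        two-shared : RationalTimesSquare (det N) ⊎ Card2 (Shared N) → Card2 (Shared N)
        two-shared (inj₁ rts) = ⊥-elim (¬rationalTimesSquare rts)
        two-shared (inj₂ two) = two

open import Data.Nat using (_*_)

lemma9p5 : (q : ℕ) → OddPrimePower q →
    (R : CommutativeRing 0ℓ 0ℓ) → IsField R → HasSize R (q * q) →
    let open PL R q in
    (Ω₁ Ω₂ : PointSet) → IsSubline Ω₁ → IsSubline Ω₂ →
    (∀ g → InSL g → ¬ SameSet (Image g Ω₁) Ω₂) →
    ∀ g → InSL g → Card0 (Image g Ω₁ ∩ Ω₂) ⊎ Card2 (Image g Ω₁ ∩ Ω₂)
lemma9p5 q ((p , k , pr , ≡.refl) , _) R isField size = subline-intersection search²
  where
  open FiniteField R isField size using (_≟_; search²)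
  open ProjectiveLine R isField _≟_ q
  open Conjugation (frobeniusInvolution {k = k} pr R isField size)
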